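{- For $n\ge 4$ and $2\le k\le n-2$, let $\mathfrak{f}_{n,k}=\mathfrak{d}^e_{n,k}-\mathfrak{d}^o_{n,k}$, where $\mathfrak{d}^e_{n,k}$ (resp. $\mathfrak{d}^o_{n,k}$) is the number of even (resp. odd) parity alternating derangements of $[n]$ with exactly $k$ excedances. Then \[ \mathfrak{f}_{n,k}=(-1)^n\min\{k-1,\;n-(k+1)\}. \]
   Context: A permutation $\sigma$ of $[n]=\{1,\dots,n\}$, in one-line notation, is a PAP if $\sigma(i)\equiv i\pmod 2$ for all $i$ (entries alternate in parity, first entry odd); a parity alternating derangement is a PAP with $\sigma(i)\ne i$ for all $i$. An excedance of $\sigma$ is an index $i$ with $\sigma(i)>i$. Parity: sign $(-1)^{n-c}$, $c$ the number of cycles (fixed points included). -}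

module Defs where

open import Data.Nat using (ℕ; zero; suc; _∸_; _%_; _≤_; _<_; _≤?_; _<?_)
import Data.Nat.Properties as ℕP
open import Data.Fin using (Fin; toℕ)
open import Data.Fin.Properties using (all?) renaming (_≟_ to _≟ᶠ_)
open import Data.List using (List; []; _∷_; [_]; map; concatMap; filter; length; allFin)
open import Data.Vec using (Vec; lookup) renaming ([] to []ᵥ; _∷_ to _∷ᵥ_)
open import Data.Integer using (ℤ; +_; -_)
open import Data.Product using (_×_)
open import Relation.Nullary using (Dec; ¬_)
open import Relation.Nullary.Decidable using (_×-dec_; _→-dec_; ¬?)
open import Relation.Binary.PropositionalEquality using (_≡_)

words : (m n : ℕ) → List (Vec (Fin m) n)
words m zero = [ []ᵥ ]
words m (suc n) = concatMap (λ x → map (x ∷ᵥ_) (words m n)) (allFin m)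

count : ∀ {a p} {A : Set a} {P : A → Set p} → ((x : A) → Dec (P x)) → List A → ℕ
count P? xs = length (filter P? xs)

-- A word σ (one-line notation, 0-indexed: position i holds σ(i)) is a permutation of [n]
-- iff i ↦ σ(i) is injective (hence bijective on the finite set).
IsPerm : ∀ {n} → Vec (Fin n) n → Set
IsPerm {n} σ = ∀ (i j : Fin n) → lookup σ i ≡ lookup σ j → i ≡ j

isPerm? : ∀ {n} (σ : Vec (Fin n) n) → Dec (IsPerm σ)
isPerm? σ = all? λ i → all? λ j → (lookup σ i ≟ᶠ lookup σ j) →-dec (i ≟ᶠ j)

-- Parity alternating: σ(i) ≡ i (mod 2). (Shifting 1-indexing to 0-indexing
-- shifts both sides by one, so this is the same condition.)
IsPA : ∀ {n} → Vec (Fin n) n → Set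
IsPA {n} σ = ∀ (i : Fin n) → toℕ (lookup σ i) % 2 ≡ toℕ i % 2

isPA? : ∀ {n} (σ : Vec (Fin n) n) → Dec (IsPA σ)
isPA? σ = all? λ i → toℕ (lookup σ i) % 2 ℕP.≟ toℕ i % 2

IsDerangement : ∀ {n} → Vec (Fin n) n → Set
IsDerangement {n} σ = ∀ (i : Fin n) → ¬ (lookup σ i ≡ i)

isDerangement? : ∀ {n} (σ : Vec (Fin n) n) → Dec (IsDerangement σ)
isDerangement? σ = all? λ i → ¬? (lookup σ i ≟ᶠ i)

excedances : ∀ {n} → Vec (Fin n) n → ℕ
excedances {n} σ = count (λ i → toℕ i <? toℕ (lookup σ i)) (allFin n)

iter : ∀ {n} → Vec (Fin n) n → ℕ → Fin n → Fin n
iter σ zero i = i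
iter σ (suc j) i = lookup σ (iter σ j i)

-- i is the least element of its cycle: σ^j(i) ≥ i for all 0 ≤ j < n
-- (every cycle has length ≤ n, so this ranges over the whole cycle).
IsCycleMin : ∀ {n} → Vec (Fin n) n → Fin n → Set
IsCycleMin {n} σ i = ∀ (j : Fin n) → toℕ i ≤ toℕ (iter σ (toℕ j) i)

isCycleMin? : ∀ {n} (σ : Vec (Fin n) n) (i : Fin n) → Dec (IsCycleMin σ i)
isCycleMin? σ i = all? λ j → toℕ i ≤? toℕ (iter σ (toℕ j) i)

-- Number of cycles (fixed points included) = number of cycle minima.
cycles : ∀ {n} → Vec (Fin n) n → ℕ
cycles {n} σ = count (isCycleMin? σ) (allFin n)

-- σ is even iff its sign (-1)^(n - c) is +1, i.e. n - c is even.
IsEven : ∀ {n} → Vec (Fin n) n → Set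
IsEven {n} σ = (n ∸ cycles σ) % 2 ≡ 0

isEven? : ∀ {n} (σ : Vec (Fin n) n) → Dec (IsEven σ)
isEven? {n} σ = (n ∸ cycles σ) % 2 ℕP.≟ 0

IsOdd : ∀ {n} → Vec (Fin n) n → Set
IsOdd {n} σ = (n ∸ cycles σ) % 2 ≡ 1

isOdd? : ∀ {n} (σ : Vec (Fin n) n) → Dec (IsOdd σ)
isOdd? {n} σ = (n ∸ cycles σ) % 2 ℕP.≟ 1

IsPADk : ∀ {n} → ℕ → Vec (Fin n) n → Set
IsPADk k σ = IsPerm σ × IsPA σ × IsDerangement σ × excedances σ ≡ k

isPADk? : ∀ {n} (k : ℕ) (σ : Vec (Fin n) n) → Dec (IsPADk k σ)
isPADk? k σ = isPerm? σ ×-dec isPA? σ ×-dec isDerangement? σ ×-dec (excedances σ ℕP.≟ k)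

dEven : ℕ → ℕ → ℕ
dEven n k = count (λ σ → isPADk? k σ ×-dec isEven? σ) (words n n)

dOdd : ℕ → ℕ → ℕ
dOdd n k = count (λ σ → isPADk? k σ ×-dec isOdd? σ) (words n n)

negOnePow : ℕ → ℤ
negOnePow zero = + 1
negOnePow (suc n) = - negOnePow n

module Submission where

-- A parity alternating permutation of [n] is a pair of permutations, one of the odd and one of the
-- even positions, and its sign, fixed points and excedances split accordingly. So the generating
-- function Q of such permutations with a prescribed fixed-point set, by sign and by excedances at
-- odd and at even positions, factorises as D a · D b, where D r = (-1)^(r-1) (t + … + t^(r-1)) is
-- the signed excedance enumerator of the derangements of [r] and a, b count the non-fixed points
-- of each parity. The factorisation is proved by induction on n, inserting the maximum n into a
-- cycle: both sides obey the same recurrence. For derangements a = ⌈n/2⌉ and b = ⌊n/2⌋, and the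
-- coefficient of t^k in (t + … + t^(a-1)) (t + … + t^(b-1)) is min(k-1, n-k-1).

open import Defs
open import Data.Nat as ℕ using (ℕ; zero; suc; _≤_; _<_; _∸_; _⊓_; _%_; _<?_; z≤n; s≤s) renaming (_+_ to _+ℕ_)
import Data.Nat.Properties as ℕP
import Data.Nat.DivMod as ℕD
import Data.Nat.Tactic.RingSolver as ℕS
open import Data.Integer using (ℤ; +_; -_; _+_; _-_; _*_; 0ℤ; 1ℤ)
import Data.Integer.Properties as ℤP
open import Data.Integer.Tactic.RingSolver using (solve-∀)
open import Data.Fin as F using (Fin; toℕ; inject₁; fromℕ)
import Data.Fin.Properties as FP
open import Data.Fin.Relation.Unary.Top using (view; ‵fromℕ; ‵inject₁)
open import Data.List using (List; []; _∷_; map; concatMap; allFin; tabulate; _++_)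
import Data.List.Properties as LP
open import Data.Vec as V using (Vec; lookup) renaming ([] to []ᵥ; _∷_ to _∷ᵥ_)
import Data.Vec.Properties as VP
open import Data.Vec.Functional using (updateAt)
open import Data.Vec.Functional.Properties using (updateAt-updates; updateAt-minimal)
open import Data.Bool using (Bool; true; false)
import Data.Bool.Properties as BP
open import Data.Maybe as Maybe using (Maybe; just; nothing)
open import Data.Product using (_×_; _,_; proj₁; proj₂; ∃; map₁)
open import Data.Sum using (_⊎_; inj₁; inj₂)
open import Data.Empty using (⊥; ⊥-elim)
open import Function using (_∘_; id; const; mk⇔)
open import Relation.Nullary using (Dec; yes; no; does; ¬_)
open import Relation.Nullary.Decidable using (_×-dec_; dec-true; dec-false; does-⇔)
open import Relation.Binary.PropositionalEquality using (_≡_; _≢_; refl; sym; trans; cong; cong₂; subst; subst₂; module ≡-Reasoning)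
open import Relation.Binary.Definitions using (tri<; tri≈; tri>)

𝟙 : ∀ {P : Set} → Dec P → ℤ
𝟙 (yes _) = 1ℤ
𝟙 (no _) = 0ℤ

𝟙-⇔ : ∀ {P Q : Set} → (P → Q) → (Q → P) → (p : Dec P) (q : Dec Q) → 𝟙 p ≡ 𝟙 q
𝟙-⇔ f g (yes p) (yes q) = refl
𝟙-⇔ f g (yes p) (no ¬q) = ⊥-elim (¬q (f p))
𝟙-⇔ f g (no ¬p) (yes q) = ⊥-elim (¬p (g q))
𝟙-⇔ f g (no ¬p) (no ¬q) = refl

𝟙-× : ∀ {P Q : Set} (p : Dec P) (q : Dec Q) → 𝟙 (p ×-dec q) ≡ 𝟙 p * 𝟙 q
𝟙-× (yes p) (yes q) = refl
𝟙-× (yes p) (no ¬q) = refl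
𝟙-× (no ¬p) (yes q) = refl
𝟙-× (no ¬p) (no ¬q) = refl

𝟙-⊎ : ∀ {P A B : Set} → (P → A ⊎ B) → (A ⊎ B → P) → (A → B → ⊥) →
  (p : Dec P) (a : Dec A) (b : Dec B) → 𝟙 p ≡ 𝟙 a + 𝟙 b
𝟙-⊎ f g d (yes p) (yes a) (yes b) = ⊥-elim (d a b)
𝟙-⊎ f g d (yes p) (yes a) (no _) = refl
𝟙-⊎ f g d (yes p) (no _) (yes b) = refl
𝟙-⊎ f g d (yes p) (no ¬a) (no ¬b) with f p
... | inj₁ a = ⊥-elim (¬a a)
... | inj₂ b = ⊥-elim (¬b b)
𝟙-⊎ f g d (no ¬p) (yes a) _ = ⊥-elim (¬p (g (inj₁ a)))
𝟙-⊎ f g d (no ¬p) (no _) (yes b) = ⊥-elim (¬p (g (inj₂ b)))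
𝟙-⊎ f g d (no ¬p) (no _) (no _) = refl

𝟙-yes : ∀ {P : Set} (p : Dec P) → P → 𝟙 p ≡ 1ℤ
𝟙-yes (yes _) _ = refl
𝟙-yes (no ¬p) x = ⊥-elim (¬p x)

𝟙-no : ∀ {P : Set} (p : Dec P) → ¬ P → 𝟙 p ≡ 0ℤ
𝟙-no (yes x) ¬p = ⊥-elim (¬p x)
𝟙-no (no _) _ = refl

𝟙-*-cong : ∀ {P : Set} (p : Dec P) {x y : ℤ} → (P → x ≡ y) → 𝟙 p * x ≡ 𝟙 p * y
𝟙-*-cong (yes p) x≡y = cong (1ℤ *_) (x≡y p)
𝟙-*-cong (no _) _ = refl

∑ : ∀ {A : Set} → List A → (A → ℤ) → ℤ
∑ [] f = 0ℤ
∑ (x ∷ xs) f = f x + ∑ xs f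

∑-cong : ∀ {A : Set} (xs : List A) {f g : A → ℤ} → (∀ x → f x ≡ g x) → ∑ xs f ≡ ∑ xs g
∑-cong [] f≗g = refl
∑-cong (x ∷ xs) f≗g = cong₂ _+_ (f≗g x) (∑-cong xs f≗g)

∑-zero : ∀ {A : Set} (xs : List A) → ∑ xs (λ _ → 0ℤ) ≡ 0ℤ
∑-zero [] = refl
∑-zero (x ∷ xs) = trans (ℤP.+-identityˡ _) (∑-zero xs)

∑-+ : ∀ {A : Set} (xs : List A) (f g : A → ℤ) → ∑ xs (λ x → f x + g x) ≡ ∑ xs f + ∑ xs g
∑-+ [] f g = refl
∑-+ (x ∷ xs) f g rewrite ∑-+ xs f g = lem (f x) (g x) (∑ xs f) (∑ xs g)
  where
  lem : ∀ a b c d → (a + b) + (c + d) ≡ (a + c) + (b + d)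
  lem = solve-∀

∑-neg : ∀ {A : Set} (xs : List A) (f : A → ℤ) → ∑ xs (λ x → - f x) ≡ - ∑ xs f
∑-neg [] f = refl
∑-neg (x ∷ xs) f rewrite ∑-neg xs f = sym (ℤP.neg-distrib-+ (f x) (∑ xs f))

∑-sub : ∀ {A : Set} (xs : List A) (f g : A → ℤ) → ∑ xs (λ x → f x - g x) ≡ ∑ xs f - ∑ xs g
∑-sub xs f g = trans (∑-+ xs f (λ x → - g x)) (cong (_+_ (∑ xs f)) (∑-neg xs g))

∑-*ˡ : ∀ {A : Set} (xs : List A) (c : ℤ) (f : A → ℤ) → ∑ xs (λ x → c * f x) ≡ c * ∑ xs f
∑-*ˡ [] c f = sym (ℤP.*-zeroʳ c)
∑-*ˡ (x ∷ xs) c f rewrite ∑-*ˡ xs c f = sym (ℤP.*-distribˡ-+ c (f x) (∑ xs f))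

∑-*ʳ : ∀ {A : Set} (xs : List A) (c : ℤ) (f : A → ℤ) → ∑ xs (λ x → f x * c) ≡ ∑ xs f * c
∑-*ʳ xs c f = trans (∑-cong xs (λ x → ℤP.*-comm (f x) c)) (trans (∑-*ˡ xs c f) (ℤP.*-comm c (∑ xs f)))

∑-++ : ∀ {A : Set} (xs ys : List A) (f : A → ℤ) → ∑ (xs ++ ys) f ≡ ∑ xs f + ∑ ys f
∑-++ [] ys f = sym (ℤP.+-identityˡ _)
∑-++ (x ∷ xs) ys f rewrite ∑-++ xs ys f = sym (ℤP.+-assoc (f x) (∑ xs f) (∑ ys f))

∑-map : ∀ {A B : Set} (g : A → B) (xs : List A) (f : B → ℤ) → ∑ (map g xs) f ≡ ∑ xs (f ∘ g)
∑-map g [] f = refl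
∑-map g (x ∷ xs) f = cong (_+_ (f (g x))) (∑-map g xs f)

∑-concatMap : ∀ {A B : Set} (g : A → List B) (xs : List A) (f : B → ℤ) →
  ∑ (concatMap g xs) f ≡ ∑ xs (λ a → ∑ (g a) f)
∑-concatMap g [] f = refl
∑-concatMap g (x ∷ xs) f rewrite ∑-++ (g x) (concatMap g xs) f | ∑-concatMap g xs f = refl

∑-comm : ∀ {A B : Set} (xs : List A) (ys : List B) (f : A → B → ℤ) →
  ∑ xs (λ a → ∑ ys (f a)) ≡ ∑ ys (λ b → ∑ xs (λ a → f a b))
∑-comm [] ys f = sym (∑-zero ys)
∑-comm (x ∷ xs) ys f rewrite ∑-comm xs ys f = sym (∑-+ ys (f x) (λ b → ∑ xs (λ a → f a b)))

count≡∑𝟙 : ∀ {A : Set} {P : A → Set} (P? : ∀ x → Dec (P x)) (xs : List A) →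
  + count P? xs ≡ ∑ xs (λ x → 𝟙 (P? x))
count≡∑𝟙 P? [] = refl
count≡∑𝟙 P? (x ∷ xs) with P? x
... | yes _ = trans (ℤP.pos-+ 1 (count P? xs)) (cong (_+_ 1ℤ) (count≡∑𝟙 P? xs))
... | no _ = trans (count≡∑𝟙 P? xs) (sym (ℤP.+-identityˡ _))

∑-tabulate : ∀ {A : Set} {n} (g : Fin n → A) (f : A → ℤ) → ∑ (tabulate g) f ≡ ∑ (allFin n) (f ∘ g)
∑-tabulate {n = zero} g f = refl
∑-tabulate {n = suc n} g f =
  cong (_+_ (f (g F.zero))) (trans (∑-tabulate (g ∘ F.suc) f) (sym (∑-tabulate F.suc (f ∘ g))))

∑-allFin-suc : ∀ {n} (f : Fin (suc n) → ℤ) → ∑ (allFin (suc n)) f ≡ f F.zero + ∑ (allFin n) (f ∘ F.suc)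
∑-allFin-suc f = cong (_+_ (f F.zero)) (∑-tabulate F.suc f)

∑-allFin-last : ∀ n (f : Fin (suc n) → ℤ) → ∑ (allFin (suc n)) f ≡ ∑ (allFin n) (f ∘ inject₁) + f (fromℕ n)
∑-allFin-last zero f = trans (ℤP.+-identityʳ (f F.zero)) (sym (ℤP.+-identityˡ (f F.zero)))
∑-allFin-last (suc n) f = begin
    ∑ (allFin (suc (suc n))) f
  ≡⟨ ∑-allFin-suc f ⟩
    f F.zero + ∑ (allFin (suc n)) (f ∘ F.suc)
  ≡⟨ cong (_+_ (f F.zero)) (∑-allFin-last n (f ∘ F.suc)) ⟩
    f F.zero + (∑ (allFin n) (f ∘ F.suc ∘ inject₁) + f (fromℕ (suc n)))
  ≡⟨ sym (ℤP.+-assoc (f F.zero) _ _) ⟩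
    (f F.zero + ∑ (allFin n) (f ∘ inject₁ ∘ F.suc)) + f (fromℕ (suc n))
  ≡⟨ cong (_+ f (fromℕ (suc n))) (sym (∑-allFin-suc (f ∘ inject₁))) ⟩
    ∑ (allFin (suc n)) (f ∘ inject₁) + f (fromℕ (suc n))
  ∎
  where open ≡-Reasoning

count-allFin-last : ∀ n {P : Fin (suc n) → Set} (P? : ∀ i → Dec (P i)) →
  + count P? (allFin (suc n)) ≡ ∑ (allFin n) (λ i → 𝟙 (P? (inject₁ i))) + 𝟙 (P? (fromℕ n))
count-allFin-last n P? = trans (count≡∑𝟙 P? (allFin (suc n))) (∑-allFin-last n (λ i → 𝟙 (P? i)))

∑-allFin-δ : ∀ {n} (y : Fin n) (h : Fin n → ℤ) → ∑ (allFin n) (λ x → 𝟙 (x FP.≟ y) * h x) ≡ h y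
∑-allFin-δ {suc n} F.zero h = begin
    ∑ (allFin (suc n)) (λ x → 𝟙 (x FP.≟ F.zero) * h x)
  ≡⟨ ∑-allFin-suc (λ x → 𝟙 (x FP.≟ F.zero) * h x) ⟩
    1ℤ * h F.zero + ∑ (allFin n) (λ x → 0ℤ * h (F.suc x))
  ≡⟨ cong₂ _+_ (ℤP.*-identityˡ (h F.zero)) (∑-zero (allFin n)) ⟩
    h F.zero + 0ℤ
  ≡⟨ ℤP.+-identityʳ (h F.zero) ⟩
    h F.zero
  ∎
  where open ≡-Reasoning
∑-allFin-δ {suc n} (F.suc y) h = begin
    ∑ (allFin (suc n)) (λ x → 𝟙 (x FP.≟ F.suc y) * h x)
  ≡⟨ ∑-allFin-suc (λ x → 𝟙 (x FP.≟ F.suc y) * h x) ⟩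
    0ℤ + ∑ (allFin n) (λ x → 𝟙 (F.suc x FP.≟ F.suc y) * h (F.suc x))
  ≡⟨ ℤP.+-identityˡ _ ⟩
    ∑ (allFin n) (λ x → 𝟙 (F.suc x FP.≟ F.suc y) * h (F.suc x))
  ≡⟨ ∑-cong (allFin n) (λ x → cong (_* h (F.suc x)) (𝟙-⇔ FP.suc-injective (cong F.suc) (F.suc x FP.≟ F.suc y) (x FP.≟ y))) ⟩
    ∑ (allFin n) (λ x → 𝟙 (x FP.≟ y) * h (F.suc x))
  ≡⟨ ∑-allFin-δ y (h ∘ F.suc) ⟩
    h (F.suc y)
  ∎
  where open ≡-Reasoning

∑-allFin-swapAt : ∀ {n} (f g : Fin n → ℤ) x → (∀ j → j ≢ x → f j ≡ g j) →
  ∑ (allFin n) f + g x ≡ ∑ (allFin n) g + f x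
∑-allFin-swapAt {suc n} f g x f≡g = begin
    ∑ (allFin (suc n)) f + g x
  ≡⟨ cong (_+ g x) (∑-allFin-suc f) ⟩
    (f F.zero + ∑ (allFin n) (f ∘ F.suc)) + g x
  ≡⟨ by-position x f≡g ⟩
    (g F.zero + ∑ (allFin n) (g ∘ F.suc)) + f x
  ≡⟨ cong (_+ f x) (sym (∑-allFin-suc g)) ⟩
    ∑ (allFin (suc n)) g + f x
  ∎
  where
  open ≡-Reasoning
  by-position : ∀ x → (∀ j → j ≢ x → f j ≡ g j) →
    (f F.zero + ∑ (allFin n) (f ∘ F.suc)) + g x ≡ (g F.zero + ∑ (allFin n) (g ∘ F.suc)) + f x
  by-position F.zero f≡g = trans (cong (λ r → (f F.zero + r) + g F.zero) (∑-cong (allFin n) (λ j → f≡g (F.suc j) λ ())))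
                                 (swap (f F.zero) (∑ (allFin n) (g ∘ F.suc)) (g F.zero))
    where
    swap : ∀ a r b → (a + r) + b ≡ (b + r) + a
    swap = solve-∀
  by-position (F.suc y) f≡g = begin
      (f F.zero + ∑ (allFin n) (f ∘ F.suc)) + g (F.suc y)
    ≡⟨ trans (ℤP.+-assoc (f F.zero) _ _)
             (cong₂ _+_ (f≡g F.zero λ ())
                        (∑-allFin-swapAt (f ∘ F.suc) (g ∘ F.suc) y (λ j j≢y → f≡g (F.suc j) (j≢y ∘ FP.suc-injective)))) ⟩
      g F.zero + (∑ (allFin n) (g ∘ F.suc) + f (F.suc y))
    ≡⟨ sym (ℤP.+-assoc (g F.zero) _ _) ⟩
      (g F.zero + ∑ (allFin n) (g ∘ F.suc)) + f (F.suc y)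
    ∎

_≟ᵥ_ : ∀ {m n} → (u v : Vec (Fin m) n) → Dec (u ≡ v)
_≟ᵥ_ = VP.≡-dec FP._≟_

∑-words-suc : ∀ m n (f : Vec (Fin m) (suc n) → ℤ) →
  ∑ (words m (suc n)) f ≡ ∑ (allFin m) (λ a → ∑ (words m n) (λ v → f (a ∷ᵥ v)))
∑-words-suc m n f = trans (∑-concatMap _ (allFin m) f) (∑-cong (allFin m) (λ a → ∑-map (a ∷ᵥ_) (words m n) f))

∑-words-δ : ∀ m n (w : Vec (Fin m) n) (h : Vec (Fin m) n → ℤ) →
  ∑ (words m n) (λ v → 𝟙 (v ≟ᵥ w) * h v) ≡ h w
∑-words-δ m zero []ᵥ h = trans (cong (_+ 0ℤ) (ℤP.*-identityˡ (h []ᵥ))) (ℤP.+-identityʳ (h []ᵥ))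
∑-words-δ m (suc n) (b ∷ᵥ w) h = begin
    ∑ (words m (suc n)) (λ v → 𝟙 (v ≟ᵥ (b ∷ᵥ w)) * h v)
  ≡⟨ ∑-words-suc m n _ ⟩
    ∑ (allFin m) (λ a → ∑ (words m n) (λ v → 𝟙 ((a ∷ᵥ v) ≟ᵥ (b ∷ᵥ w)) * h (a ∷ᵥ v)))
  ≡⟨ ∑-cong (allFin m) (λ a → ∑-cong (words m n) (λ v → cong (_* h (a ∷ᵥ v)) (𝟙-∷ a v))) ⟩
    ∑ (allFin m) (λ a → ∑ (words m n) (λ v → (𝟙 (a FP.≟ b) * 𝟙 (v ≟ᵥ w)) * h (a ∷ᵥ v)))
  ≡⟨ ∑-cong (allFin m) (λ a → trans (∑-cong (words m n) (λ v → ℤP.*-assoc (𝟙 (a FP.≟ b)) _ _))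
                                       (∑-*ˡ (words m n) (𝟙 (a FP.≟ b)) _)) ⟩
    ∑ (allFin m) (λ a → 𝟙 (a FP.≟ b) * ∑ (words m n) (λ v → 𝟙 (v ≟ᵥ w) * h (a ∷ᵥ v)))
  ≡⟨ ∑-cong (allFin m) (λ a → cong (𝟙 (a FP.≟ b) *_) (∑-words-δ m n w (λ v → h (a ∷ᵥ v)))) ⟩
    ∑ (allFin m) (λ a → 𝟙 (a FP.≟ b) * h (a ∷ᵥ w))
  ≡⟨ ∑-allFin-δ b (λ a → h (a ∷ᵥ w)) ⟩
    h (b ∷ᵥ w)
  ∎
  where
  open ≡-Reasoning
  𝟙-∷ : ∀ a v → 𝟙 ((a ∷ᵥ v) ≟ᵥ (b ∷ᵥ w)) ≡ 𝟙 (a FP.≟ b) * 𝟙 (v ≟ᵥ w)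
  𝟙-∷ a v = trans (𝟙-⇔ (λ e → VP.∷-injectiveˡ e , VP.∷-injectiveʳ e) (λ { (refl , refl) → refl }) _ ((a FP.≟ b) ×-dec (v ≟ᵥ w)))
                  (𝟙-× (a FP.≟ b) (v ≟ᵥ w))

lower? : ∀ {n} → Fin (suc n) → Maybe (Fin n)
lower? {zero} F.zero = nothing
lower? {suc n} F.zero = just F.zero
lower? {suc n} (F.suc i) = Maybe.map F.suc (lower? i)

lower?-inject₁ : ∀ {n} (j : Fin n) → lower? (inject₁ j) ≡ just j
lower?-inject₁ {suc n} F.zero = refl
lower?-inject₁ {suc n} (F.suc j) rewrite lower?-inject₁ j = refl

lower?-fromℕ : ∀ n → lower? (fromℕ n) ≡ nothing
lower?-fromℕ zero = refl
lower?-fromℕ (suc n) rewrite lower?-fromℕ n = refl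

inject₁≢fromℕ : ∀ {n} (j : Fin n) → inject₁ j ≢ fromℕ n
inject₁≢fromℕ j e = FP.fromℕ≢inject₁ (sym e)

inject₁<fromℕ : ∀ {n} (i : Fin n) → toℕ (inject₁ i) < toℕ (fromℕ n)
inject₁<fromℕ {n} i = subst (toℕ (inject₁ i) <_) (sym (FP.toℕ-fromℕ n)) (FP.inject₁ℕ< i)

-- insMax u x inserts the new maximum n into the cycle of u right after x
-- (so x ↦ n ↦ u x), or as a new fixed point when x = n.
insMaxAt : ∀ {n} → Vec (Fin n) n → Maybe (Fin n) → Maybe (Fin n) → Fin (suc n)
insMaxAt {n} u nothing nothing = fromℕ n
insMaxAt u nothing (just x) = inject₁ (lookup u x)
insMaxAt u (just j) nothing = inject₁ (lookup u j)
insMaxAt {n} u (just j) (just x) with j FP.≟ x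
... | yes _ = fromℕ n
... | no _ = inject₁ (lookup u j)

insMax : ∀ {n} → Vec (Fin n) n → Fin (suc n) → Vec (Fin (suc n)) (suc n)
insMax u x = V.tabulate (λ i → insMaxAt u (lower? i) (lower? x))

lookup-insMax : ∀ {n} (u : Vec (Fin n) n) x i → lookup (insMax u x) i ≡ insMaxAt u (lower? i) (lower? x)
lookup-insMax u x i = VP.lookup∘tabulate (λ i → insMaxAt u (lower? i) (lower? x)) i

insMax-fix-fromℕ : ∀ {n} (u : Vec (Fin n) n) → lookup (insMax u (fromℕ n)) (fromℕ n) ≡ fromℕ n
insMax-fix-fromℕ {n} u rewrite lookup-insMax u (fromℕ n) (fromℕ n) | lower?-fromℕ n = refl

insMax-fix-inject₁ : ∀ {n} (u : Vec (Fin n) n) j → lookup (insMax u (fromℕ n)) (inject₁ j) ≡ inject₁ (lookup u j)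
insMax-fix-inject₁ {n} u j rewrite lookup-insMax u (fromℕ n) (inject₁ j) | lower?-fromℕ n | lower?-inject₁ j = refl

insMax-fromℕ : ∀ {n} (u : Vec (Fin n) n) x → lookup (insMax u (inject₁ x)) (fromℕ n) ≡ inject₁ (lookup u x)
insMax-fromℕ {n} u x rewrite lookup-insMax u (inject₁ x) (fromℕ n) | lower?-fromℕ n | lower?-inject₁ x = refl

insMax-at : ∀ {n} (u : Vec (Fin n) n) x → lookup (insMax u (inject₁ x)) (inject₁ x) ≡ fromℕ n
insMax-at {n} u x rewrite lookup-insMax u (inject₁ x) (inject₁ x) | lower?-inject₁ x with x FP.≟ x
... | yes _ = refl
... | no x≢x = ⊥-elim (x≢x refl)

insMax-other : ∀ {n} (u : Vec (Fin n) n) x j → j ≢ x →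
  lookup (insMax u (inject₁ x)) (inject₁ j) ≡ inject₁ (lookup u j)
insMax-other {n} u x j j≢x rewrite lookup-insMax u (inject₁ x) (inject₁ j) | lower?-inject₁ x | lower?-inject₁ j with j FP.≟ x
... | yes j≡x = ⊥-elim (j≢x j≡x)
... | no _ = refl

insMax-max : ∀ {n} (u : Vec (Fin n) n) x → lookup (insMax u x) x ≡ fromℕ n
insMax-max u x with view x
... | ‵fromℕ = insMax-fix-fromℕ u
... | ‵inject₁ x' = insMax-at u x'

insMax-max⁻¹ : ∀ {n} (u : Vec (Fin n) n) x i → lookup (insMax u x) i ≡ fromℕ n → i ≡ x
insMax-max⁻¹ u x i e with view x | view i
... | ‵fromℕ | ‵fromℕ = refl
... | ‵fromℕ | ‵inject₁ j = ⊥-elim (inject₁≢fromℕ _ (trans (sym (insMax-fix-inject₁ u j)) e))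
... | ‵inject₁ x' | ‵fromℕ = ⊥-elim (inject₁≢fromℕ _ (trans (sym (insMax-fromℕ u x')) e))
... | ‵inject₁ x' | ‵inject₁ j with j FP.≟ x'
...   | yes refl = refl
...   | no j≢x = ⊥-elim (inject₁≢fromℕ _ (trans (sym (insMax-other u x' j j≢x)) e))

insMax-perm : ∀ {n} (u : Vec (Fin n) n) x → IsPerm u → IsPerm (insMax u x)
insMax-perm u x pu i j e with lookup (insMax u x) i FP.≟ fromℕ _
... | yes top = trans (insMax-max⁻¹ u x i top) (sym (insMax-max⁻¹ u x j (trans (sym e) top)))
... | no ¬top = below ¬top e
  where
  below : ∀ {i j} → lookup (insMax u x) i ≢ fromℕ _ → lookup (insMax u x) i ≡ lookup (insMax u x) j → i ≡ j
  below {i} {j} ¬top e with view x | view i | view j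
  ... | ‵fromℕ | ‵fromℕ | _ = ⊥-elim (¬top (insMax-fix-fromℕ u))
  ... | ‵fromℕ | ‵inject₁ a | ‵fromℕ = ⊥-elim (¬top (trans e (insMax-fix-fromℕ u)))
  ... | ‵fromℕ | ‵inject₁ a | ‵inject₁ b =
    cong inject₁ (pu a b (FP.inject₁-injective (trans (sym (insMax-fix-inject₁ u a)) (trans e (insMax-fix-inject₁ u b)))))
  ... | ‵inject₁ x' | ‵fromℕ | ‵fromℕ = refl
  ... | ‵inject₁ x' | ‵fromℕ | ‵inject₁ b with b FP.≟ x'
  ...   | yes refl = ⊥-elim (¬top (trans e (insMax-at u x')))
  ...   | no b≢x = ⊥-elim (b≢x (pu b x' (FP.inject₁-injective (trans (sym (insMax-other u x' b b≢x)) (trans (sym e) (insMax-fromℕ u x'))))))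
  below ¬top e | ‵inject₁ x' | ‵inject₁ a | ‵fromℕ with a FP.≟ x'
  ...   | yes refl = ⊥-elim (¬top (insMax-at u x'))
  ...   | no a≢x = ⊥-elim (a≢x (pu a x' (FP.inject₁-injective (trans (sym (insMax-other u x' a a≢x)) (trans e (insMax-fromℕ u x'))))))
  below ¬top e | ‵inject₁ x' | ‵inject₁ a | ‵inject₁ b with a FP.≟ x' | b FP.≟ x'
  ...   | yes refl | _ = ⊥-elim (¬top (insMax-at u x'))
  ...   | no _ | yes refl = ⊥-elim (¬top (trans e (insMax-at u x')))
  ...   | no a≢x | no b≢x =
    cong inject₁ (pu a b (FP.inject₁-injective (trans (sym (insMax-other u x' a a≢x)) (trans e (insMax-other u x' b b≢x)))))

insMax-perm⁻¹ : ∀ {n} (u : Vec (Fin n) n) x → IsPerm (insMax u x) → IsPerm u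
insMax-perm⁻¹ u x pv a b e with view x
... | ‵fromℕ =
  FP.inject₁-injective (pv (inject₁ a) (inject₁ b) (trans (insMax-fix-inject₁ u a) (trans (cong inject₁ e) (sym (insMax-fix-inject₁ u b)))))
... | ‵inject₁ x' with a FP.≟ x' | b FP.≟ x'
...   | yes refl | yes refl = refl
...   | yes refl | no b≢x =
  ⊥-elim (FP.fromℕ≢inject₁ (pv (fromℕ _) (inject₁ b) (trans (insMax-fromℕ u x') (trans (cong inject₁ e) (sym (insMax-other u x' b b≢x))))))
...   | no a≢x | yes refl =
  ⊥-elim (FP.fromℕ≢inject₁ (pv (fromℕ _) (inject₁ a) (trans (insMax-fromℕ u x') (trans (cong inject₁ (sym e)) (sym (insMax-other u x' a a≢x))))))
...   | no a≢x | no b≢x =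
  FP.inject₁-injective (pv (inject₁ a) (inject₁ b) (trans (insMax-other u x' a a≢x) (trans (cong inject₁ e) (sym (insMax-other u x' b b≢x)))))

≤fromℕ⇒≡fromℕ : ∀ {n} (i : Fin (suc n)) → n ≤ toℕ i → i ≡ fromℕ n
≤fromℕ⇒≡fromℕ {n} i n≤i = FP.toℕ-injective (trans (ℕP.≤-antisym (ℕP.≤-pred (FP.toℕ<n i)) n≤i) (sym (FP.toℕ-fromℕ n)))

perm-hits-fromℕ : ∀ {n} (v : Vec (Fin (suc n)) (suc n)) → IsPerm v → ∃ λ i → lookup v i ≡ fromℕ n
perm-hits-fromℕ {n} v pv with FP.injective⇒existsPivot (λ {i} {j} → pv i j) (fromℕ n)
... | i , _ , n≤vi = i , ≤fromℕ⇒≡fromℕ (lookup v i) (subst (_≤ toℕ (lookup v i)) (FP.toℕ-fromℕ n) n≤vi)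

maxPos : ∀ {n} → Vec (Fin (suc n)) (suc n) → Fin (suc n)
maxPos {n} v with FP.any? (λ i → lookup v i FP.≟ fromℕ n)
... | yes (i , _) = i
... | no _ = fromℕ n

maxPos-insMax : ∀ {n} (u : Vec (Fin n) n) x → maxPos (insMax u x) ≡ x
maxPos-insMax {n} u x with FP.any? (λ i → lookup (insMax u x) i FP.≟ fromℕ n)
... | yes (i , e) = insMax-max⁻¹ u x i e
... | no ∄ = ⊥-elim (∄ (x , insMax-max u x))

lookup-maxPos : ∀ {n} (v : Vec (Fin (suc n)) (suc n)) → IsPerm v → lookup v (maxPos v) ≡ fromℕ n
lookup-maxPos {n} v pv with FP.any? (λ i → lookup v i FP.≟ fromℕ n)
... | yes (i , e) = e
... | no ∄ = ⊥-elim (∄ (perm-hits-fromℕ v pv))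

-- The last clause is a junk value: for a permutation v, v j = n = v n forces j = n.
removeMaxAt : ∀ {n} → Maybe (Fin n) → Maybe (Fin n) → Fin n → Fin n
removeMaxAt (just y) _ j = y
removeMaxAt nothing (just z) j = z
removeMaxAt nothing nothing j = j

removeMax : ∀ {n} → Vec (Fin (suc n)) (suc n) → Vec (Fin n) n
removeMax {n} v = V.tabulate (λ j → removeMaxAt (lower? (lookup v (inject₁ j))) (lower? (lookup v (fromℕ n))) j)

lookup-removeMax : ∀ {n} (v : Vec (Fin (suc n)) (suc n)) j →
  lookup (removeMax v) j ≡ removeMaxAt (lower? (lookup v (inject₁ j))) (lower? (lookup v (fromℕ n))) j
lookup-removeMax {n} v j = VP.lookup∘tabulate (λ j → removeMaxAt (lower? (lookup v (inject₁ j))) (lower? (lookup v (fromℕ n))) j) j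

removeMaxAt-below : ∀ {n} (a : Fin (suc n)) → a ≢ fromℕ n → ∀ m j → inject₁ (removeMaxAt (lower? a) m j) ≡ a
removeMaxAt-below a a≢n m j with view a
... | ‵fromℕ = ⊥-elim (a≢n refl)
... | ‵inject₁ y rewrite lower?-inject₁ y = refl

removeMaxAt-above : ∀ {n} (b : Fin (suc n)) → b ≢ fromℕ n → ∀ j → inject₁ (removeMaxAt nothing (lower? b) j) ≡ b
removeMaxAt-above b b≢n j with view b
... | ‵fromℕ = ⊥-elim (b≢n refl)
... | ‵inject₁ y rewrite lower?-inject₁ y = refl

≗⇒≡ : ∀ {A : Set} {n} {u v : Vec A n} → (∀ i → lookup u i ≡ lookup v i) → u ≡ v
≗⇒≡ {u = u} {v} u≗v = trans (sym (VP.tabulate∘lookup u)) (trans (VP.tabulate-cong u≗v) (VP.tabulate∘lookup v))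

removeMax-insMax : ∀ {n} (u : Vec (Fin n) n) x → removeMax (insMax u x) ≡ u
removeMax-insMax {n} u x = ≗⇒≡ pointwise
  where
  pointwise : ∀ j → lookup (removeMax (insMax u x)) j ≡ lookup u j
  pointwise j with view x
  ... | ‵fromℕ rewrite lookup-removeMax (insMax u (fromℕ n)) j | insMax-fix-inject₁ u j | lower?-inject₁ (lookup u j) = refl
  ... | ‵inject₁ x' with j FP.≟ x'
  ...   | yes refl rewrite lookup-removeMax (insMax u (inject₁ j)) j | insMax-at u j | insMax-fromℕ u j
                         | lower?-fromℕ n | lower?-inject₁ (lookup u j) = refl
  ...   | no j≢x rewrite lookup-removeMax (insMax u (inject₁ x')) j | insMax-other u x' j j≢x | lower?-inject₁ (lookup u j) = refl

insMax-removeMax : ∀ {n} (v : Vec (Fin (suc n)) (suc n)) → IsPerm v → insMax (removeMax v) (maxPos v) ≡ v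
insMax-removeMax {n} v pv = ≗⇒≡ (pointwise (lookup-maxPos v pv))
  where
  below : ∀ {i} j → i ≢ inject₁ j → lookup v i ≡ fromℕ n → lookup v (inject₁ j) ≢ fromℕ n
  below j i≢j vi e = i≢j (pv _ _ (trans vi (sym e)))
  pointwise : ∀ {X} → lookup v X ≡ fromℕ n → ∀ i → lookup (insMax (removeMax v) X) i ≡ lookup v i
  pointwise {X} vX i with view X | view i
  ... | ‵fromℕ | ‵fromℕ = trans (insMax-fix-fromℕ (removeMax v)) (sym vX)
  ... | ‵fromℕ | ‵inject₁ j = trans (insMax-fix-inject₁ (removeMax v) j) (trans (cong inject₁ (lookup-removeMax v j))
     (removeMaxAt-below (lookup v (inject₁ j)) (below j FP.fromℕ≢inject₁ vX) _ j))
  ... | ‵inject₁ x | ‵fromℕ = trans (insMax-fromℕ (removeMax v) x) (trans (cong inject₁ (lookup-removeMax v x))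
     (trans (cong (λ z → inject₁ (removeMaxAt (lower? z) (lower? (lookup v (fromℕ n))) x)) vX)
       (trans (cong (λ z → inject₁ (removeMaxAt z (lower? (lookup v (fromℕ n))) x)) (lower?-fromℕ n))
         (removeMaxAt-above (lookup v (fromℕ n)) (λ e → FP.fromℕ≢inject₁ (pv _ _ (trans e (sym vX)))) x))))
  ... | ‵inject₁ x | ‵inject₁ j with j FP.≟ x
  ...   | yes refl = trans (insMax-at (removeMax v) j) (sym vX)
  ...   | no j≢x = trans (insMax-other (removeMax v) x j j≢x) (trans (cong inject₁ (lookup-removeMax v j))
     (removeMaxAt-below (lookup v (inject₁ j)) (below j (j≢x ∘ sym ∘ FP.inject₁-injective) vX) _ j))

∑Perm : ∀ n → (Vec (Fin n) n → ℤ) → ℤ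
∑Perm n w = ∑ (words n n) (λ v → 𝟙 (isPerm? v) * w v)

-- (u , x) ↦ insMax u x is a bijection onto the permutations, with inverse v ↦ (removeMax v , maxPos v).
𝟙-insMax : ∀ {n} (v : Vec (Fin (suc n)) (suc n)) (u : Vec (Fin n) n) (x : Fin (suc n)) →
  𝟙 (isPerm? u) * 𝟙 (v ≟ᵥ insMax u x) ≡ 𝟙 (u ≟ᵥ removeMax v) * (𝟙 (x FP.≟ maxPos v) * 𝟙 (isPerm? v))
𝟙-insMax v u x = begin
    𝟙 (isPerm? u) * 𝟙 (v ≟ᵥ insMax u x)
  ≡⟨ sym (𝟙-× (isPerm? u) (v ≟ᵥ insMax u x)) ⟩
    𝟙 (isPerm? u ×-dec (v ≟ᵥ insMax u x))
  ≡⟨ 𝟙-⇔ to from (isPerm? u ×-dec (v ≟ᵥ insMax u x)) ((u ≟ᵥ removeMax v) ×-dec ((x FP.≟ maxPos v) ×-dec isPerm? v)) ⟩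
    𝟙 ((u ≟ᵥ removeMax v) ×-dec ((x FP.≟ maxPos v) ×-dec isPerm? v))
  ≡⟨ trans (𝟙-× (u ≟ᵥ removeMax v) _) (cong (𝟙 (u ≟ᵥ removeMax v) *_) (𝟙-× (x FP.≟ maxPos v) (isPerm? v))) ⟩
    𝟙 (u ≟ᵥ removeMax v) * (𝟙 (x FP.≟ maxPos v) * 𝟙 (isPerm? v))
  ∎
  where
  open ≡-Reasoning
  to : IsPerm u × v ≡ insMax u x → u ≡ removeMax v × (x ≡ maxPos v × IsPerm v)
  to (pu , refl) = sym (removeMax-insMax u x) , sym (maxPos-insMax u x) , insMax-perm u x pu
  from : u ≡ removeMax v × (x ≡ maxPos v × IsPerm v) → IsPerm u × v ≡ insMax u x
  from (refl , refl , pv) = insMax-perm⁻¹ (removeMax v) (maxPos v) (subst IsPerm (sym (insMax-removeMax v pv)) pv)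
                          , sym (insMax-removeMax v pv)

∑-fibre-insMax : ∀ n (v : Vec (Fin (suc n)) (suc n)) →
  ∑ (words n n) (λ u → ∑ (allFin (suc n)) (λ x → 𝟙 (isPerm? u) * 𝟙 (v ≟ᵥ insMax u x))) ≡ 𝟙 (isPerm? v)
∑-fibre-insMax n v = begin
    ∑ (words n n) (λ u → ∑ (allFin (suc n)) (λ x → 𝟙 (isPerm? u) * 𝟙 (v ≟ᵥ insMax u x)))
  ≡⟨ ∑-cong (words n n) (λ u → trans (∑-cong (allFin (suc n)) (𝟙-insMax v u))
                                      (∑-*ˡ (allFin (suc n)) (𝟙 (u ≟ᵥ removeMax v)) (λ x → 𝟙 (x FP.≟ maxPos v) * 𝟙 (isPerm? v)))) ⟩
    ∑ (words n n) (λ u → 𝟙 (u ≟ᵥ removeMax v) * ∑ (allFin (suc n)) (λ x → 𝟙 (x FP.≟ maxPos v) * 𝟙 (isPerm? v)))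
  ≡⟨ ∑-words-δ n n (removeMax v) _ ⟩
    ∑ (allFin (suc n)) (λ x → 𝟙 (x FP.≟ maxPos v) * 𝟙 (isPerm? v))
  ≡⟨ ∑-allFin-δ (maxPos v) (λ _ → 𝟙 (isPerm? v)) ⟩
    𝟙 (isPerm? v)
  ∎
  where open ≡-Reasoning

∑Perm-suc : ∀ n (w : Vec (Fin (suc n)) (suc n) → ℤ) →
  ∑Perm (suc n) w ≡ ∑Perm n (λ u → ∑ (allFin (suc n)) (λ x → w (insMax u x)))
∑Perm-suc n w = begin
    ∑ Vs (λ v → 𝟙 (isPerm? v) * w v)
  ≡⟨ ∑-cong Vs (λ v → cong (_* w v) (sym (∑-fibre-insMax n v))) ⟩
    ∑ Vs (λ v → ∑ Us (λ u → ∑ Xs (λ x → δ u x v)) * w v)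
  ≡⟨ ∑-cong Vs (λ v → trans (sym (∑-*ʳ Us (w v) (λ u → ∑ Xs (λ x → δ u x v))))
                                      (∑-cong Us (λ u → sym (∑-*ʳ Xs (w v) (λ x → δ u x v))))) ⟩
    ∑ Vs (λ v → ∑ Us (λ u → ∑ Xs (λ x → δ u x v * w v)))
  ≡⟨ trans (∑-comm Vs Us (λ v u → ∑ Xs (λ x → δ u x v * w v)))
           (∑-cong Us (λ u → ∑-comm Vs Xs (λ v x → δ u x v * w v))) ⟩
    ∑ Us (λ u → ∑ Xs (λ x → ∑ Vs (λ v → δ u x v * w v)))
  ≡⟨ ∑-cong Us (λ u → ∑-cong Xs (λ x → pick u x)) ⟩
    ∑ Us (λ u → ∑ Xs (λ x → 𝟙 (isPerm? u) * w (insMax u x)))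
  ≡⟨ ∑-cong Us (λ u → ∑-*ˡ Xs (𝟙 (isPerm? u)) (λ x → w (insMax u x))) ⟩
    ∑Perm n (λ u → ∑ Xs (λ x → w (insMax u x)))
  ∎
  where
  open ≡-Reasoning
  Vs : List (Vec (Fin (suc n)) (suc n))
  Vs = words (suc n) (suc n)
  Us : List (Vec (Fin n) n)
  Us = words n n
  Xs : List (Fin (suc n))
  Xs = allFin (suc n)
  δ : Vec (Fin n) n → Fin (suc n) → Vec (Fin (suc n)) (suc n) → ℤ
  δ u x v = 𝟙 (isPerm? u) * 𝟙 (v ≟ᵥ insMax u x)
  pick : ∀ u x → ∑ Vs (λ v → δ u x v * w v) ≡ 𝟙 (isPerm? u) * w (insMax u x)
  pick u x = begin
      ∑ Vs (λ v → δ u x v * w v)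
    ≡⟨ ∑-cong Vs (λ v → ℤP.*-assoc (𝟙 (isPerm? u)) _ (w v)) ⟩
      ∑ Vs (λ v → 𝟙 (isPerm? u) * (𝟙 (v ≟ᵥ insMax u x) * w v))
    ≡⟨ ∑-*ˡ Vs (𝟙 (isPerm? u)) _ ⟩
      𝟙 (isPerm? u) * ∑ Vs (λ v → 𝟙 (v ≟ᵥ insMax u x) * w v)
    ≡⟨ cong (𝟙 (isPerm? u) *_) (∑-words-δ (suc n) (suc n) (insMax u x) w) ⟩
      𝟙 (isPerm? u) * w (insMax u x)
    ∎

iter-+ : ∀ {n} (σ : Vec (Fin n) n) a b i → iter σ (a +ℕ b) i ≡ iter σ a (iter σ b i)
iter-+ σ zero b i = refl
iter-+ σ (suc a) b i = cong (lookup σ) (iter-+ σ a b i)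

iter-injective : ∀ {n} (σ : Vec (Fin n) n) → IsPerm σ → ∀ a {i k} → iter σ a i ≡ iter σ a k → i ≡ k
iter-injective σ pσ zero e = e
iter-injective σ pσ (suc a) e = iter-injective σ pσ a (pσ _ _ e)

iter-* : ∀ {n} (σ : Vec (Fin n) n) d i → iter σ d i ≡ i → ∀ q → iter σ (q ℕ.* d) i ≡ i
iter-* σ d i σᵈi≡i zero = refl
iter-* σ d i σᵈi≡i (suc q) = trans (iter-+ σ d (q ℕ.* d) i) (trans (cong (iter σ d) (iter-* σ d i σᵈi≡i q)) σᵈi≡i)

record Period {n} (σ : Vec (Fin n) n) (i : Fin n) : Set where
  field
    d : ℕ
    d-pos : 1 ≤ d
    d≤n : d ≤ n
    iter-d : iter σ d i ≡ i

period : ∀ {n} (σ : Vec (Fin n) n) → IsPerm σ → (i : Fin n) → Period σ i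
period {n} σ pσ i with FP.pigeonhole (ℕP.n<1+n n) (λ a → iter σ (toℕ a) i)
... | a , b , a<b , e = record
  { d = toℕ b ∸ toℕ a
  ; d-pos = ℕP.m<n⇒0<n∸m a<b
  ; d≤n = ℕP.≤-trans (ℕP.m∸n≤m (toℕ b) (toℕ a)) (ℕP.≤-pred (FP.toℕ<n b))
  ; iter-d = sym (iter-injective σ pσ (toℕ a) (trans e
      (trans (cong (λ z → iter σ z i) (sym (ℕP.m+[n∸m]≡n (ℕP.<⇒≤ a<b)))) (iter-+ σ (toℕ a) (toℕ b ∸ toℕ a) i))))
  }

iter-below-n : ∀ {n} (σ : Vec (Fin n) n) → IsPerm σ → ∀ j i → ∃ λ (j' : Fin n) → iter σ j i ≡ iter σ (toℕ j') i
iter-below-n {n} σ pσ j i = F.fromℕ< r<n , trans σʲ≡σʳ (cong (λ z → iter σ z i) (sym (FP.toℕ-fromℕ< r<n)))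
  where
  open Period (period σ pσ i)
  instance
    _ : ℕ.NonZero d
    _ = ℕ.>-nonZero d-pos
  r<n : j % d < n
  r<n = ℕP.<-≤-trans (ℕD.m%n<n j d) d≤n
  σʲ≡σʳ : iter σ j i ≡ iter σ (j % d) i
  σʲ≡σʳ = trans (cong (λ z → iter σ z i) (ℕD.m≡m%n+[m/n]*n j d))
           (trans (iter-+ σ (j % d) ((j ℕD./ d) ℕ.* d) i) (cong (iter σ (j % d)) (iter-* σ d i iter-d (j ℕD./ d))))

IsCycleMinℕ : ∀ {n} → Vec (Fin n) n → Fin n → Set
IsCycleMinℕ σ i = ∀ j → toℕ i ≤ toℕ (iter σ j i)

IsCycleMin⇒IsCycleMinℕ : ∀ {n} (σ : Vec (Fin n) n) → IsPerm σ → ∀ {i} → IsCycleMin σ i → IsCycleMinℕ σ i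
IsCycleMin⇒IsCycleMinℕ σ pσ {i} cm j with iter-below-n σ pσ j i
... | j' , e = subst (λ z → toℕ i ≤ toℕ z) (sym e) (cm j')

𝟙-isCycleMin : ∀ {m n} (σ : Vec (Fin m) m) (τ : Vec (Fin n) n) → IsPerm σ → IsPerm τ → ∀ i k →
  (IsCycleMinℕ σ i → IsCycleMinℕ τ k) → (IsCycleMinℕ τ k → IsCycleMinℕ σ i) →
  𝟙 (isCycleMin? σ i) ≡ 𝟙 (isCycleMin? τ k)
𝟙-isCycleMin σ τ pσ pτ i k to from = 𝟙-⇔
  (λ c j → to (IsCycleMin⇒IsCycleMinℕ σ pσ c) (toℕ j))
  (λ c j → from (IsCycleMin⇒IsCycleMinℕ τ pτ c) (toℕ j)) _ _

toℕ-inject₁-≤ : ∀ {n} {i j : Fin n} → toℕ i ≤ toℕ j → toℕ (inject₁ i) ≤ toℕ (inject₁ j)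
toℕ-inject₁-≤ {i = i} {j} = subst₂ _≤_ (sym (FP.toℕ-inject₁ i)) (sym (FP.toℕ-inject₁ j))

toℕ-inject₁-≤⁻¹ : ∀ {n} {i j : Fin n} → toℕ (inject₁ i) ≤ toℕ (inject₁ j) → toℕ i ≤ toℕ j
toℕ-inject₁-≤⁻¹ {i = i} {j} = subst₂ _≤_ (FP.toℕ-inject₁ i) (FP.toℕ-inject₁ j)

iter-insMax-fix : ∀ {n} (u : Vec (Fin n) n) j i → iter (insMax u (fromℕ n)) j (inject₁ i) ≡ inject₁ (iter u j i)
iter-insMax-fix u zero i = refl
iter-insMax-fix u (suc j) i = trans (cong (lookup (insMax u (fromℕ _))) (iter-insMax-fix u j i)) (insMax-fix-inject₁ u (iter u j i))

iter-insMax-fix-fromℕ : ∀ {n} (u : Vec (Fin n) n) j → iter (insMax u (fromℕ n)) j (fromℕ n) ≡ fromℕ n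
iter-insMax-fix-fromℕ u zero = refl
iter-insMax-fix-fromℕ u (suc j) = trans (cong (lookup (insMax u (fromℕ _))) (iter-insMax-fix-fromℕ u j)) (insMax-fix-fromℕ u)

cycles-insMax-fix : ∀ {n} (u : Vec (Fin n) n) → IsPerm u → cycles (insMax u (fromℕ n)) ≡ suc (cycles u)
cycles-insMax-fix {n} u pu = ℤP.+-injective (begin
    + cycles τ
  ≡⟨ count-allFin-last n (isCycleMin? τ) ⟩
    ∑ (allFin n) (λ i → 𝟙 (isCycleMin? τ (inject₁ i))) + 𝟙 (isCycleMin? τ (fromℕ n))
  ≡⟨ cong₂ _+_ (∑-cong (allFin n) (λ i → 𝟙-isCycleMin τ u pτ pu (inject₁ i) i
                   (λ c j → toℕ-inject₁-≤⁻¹ (subst (λ z → toℕ (inject₁ i) ≤ toℕ z) (iter-insMax-fix u j i) (c j)))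
                   (λ c j → subst (λ z → toℕ (inject₁ i) ≤ toℕ z) (sym (iter-insMax-fix u j i)) (toℕ-inject₁-≤ (c j)))))
               (𝟙-yes (isCycleMin? τ (fromℕ n))
                      (λ j → subst (λ z → toℕ (fromℕ n) ≤ toℕ z) (sym (iter-insMax-fix-fromℕ u (toℕ j))) ℕP.≤-refl)) ⟩
    ∑ (allFin n) (λ i → 𝟙 (isCycleMin? u i)) + 1ℤ
  ≡⟨ cong (_+ 1ℤ) (sym (count≡∑𝟙 (isCycleMin? u) (allFin n))) ⟩
    + cycles u + 1ℤ
  ≡⟨ ℤP.+-comm (+ cycles u) 1ℤ ⟩
    + suc (cycles u)
  ∎)
  where
  open ≡-Reasoning
  τ : Vec (Fin (suc n)) (suc n)
  τ = insMax u (fromℕ n)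
  pτ : IsPerm τ
  pτ = insMax-perm u (fromℕ n) pu

-- Inserting n after x into the cycle of x leaves every other orbit, and every cycle minimum, unchanged.
module CycleInsertion {n} (u : Vec (Fin n) n) (x : Fin n) where
  τ : Vec (Fin (suc n)) (suc n)
  τ = insMax u (inject₁ x)

  step : ∀ y → (y ≡ x × lookup τ (inject₁ y) ≡ fromℕ n) ⊎ (y ≢ x × lookup τ (inject₁ y) ≡ inject₁ (lookup u y))
  step y with y FP.≟ x
  ... | yes refl = inj₁ (refl , insMax-at u y)
  ... | no y≢x = inj₂ (y≢x , insMax-other u x y y≢x)

  orbit-u⊆τ : ∀ i a → ∃ λ j → iter τ j (inject₁ i) ≡ inject₁ (iter u a i)
  orbit-u⊆τ i zero = 0 , refl
  orbit-u⊆τ i (suc a) with orbit-u⊆τ i a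
  ... | j , e with step (iter u a i)
  ...   | inj₁ (refl , τy≡n) = suc (suc j) , trans (cong (lookup τ) (trans (cong (lookup τ) e) τy≡n)) (insMax-fromℕ u x)
  ...   | inj₂ (_ , τy≡uy) = suc j , trans (cong (lookup τ) e) τy≡uy

  InOrbit-u : Fin n → Fin (suc n) → Set
  InOrbit-u i y = (∃ λ a → y ≡ inject₁ (iter u a i)) ⊎ (y ≡ fromℕ n × ∃ λ a → iter u a i ≡ x)

  orbit-τ⊆u : ∀ i j → InOrbit-u i (iter τ j (inject₁ i))
  orbit-τ⊆u i zero = inj₁ (0 , refl)
  orbit-τ⊆u i (suc j) with orbit-τ⊆u i j
  ... | inj₁ (a , e) with step (iter u a i)
  ...   | inj₁ (y≡x , τy≡n) = inj₂ (trans (cong (lookup τ) e) τy≡n , a , y≡x)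
  ...   | inj₂ (_ , τy≡uy) = inj₁ (suc a , trans (cong (lookup τ) e) τy≡uy)
  orbit-τ⊆u i (suc j) | inj₂ (e , a , uᵃi≡x) =
    inj₁ (suc a , trans (cong (lookup τ) e) (trans (insMax-fromℕ u x) (cong (λ z → inject₁ (lookup u z)) (sym uᵃi≡x))))

  cycleMin⇒ : ∀ i → IsCycleMinℕ τ (inject₁ i) → IsCycleMinℕ u i
  cycleMin⇒ i c a with orbit-u⊆τ i a
  ... | j , e = toℕ-inject₁-≤⁻¹ (subst (λ z → toℕ (inject₁ i) ≤ toℕ z) e (c j))

  cycleMin⇐ : ∀ i → IsCycleMinℕ u i → IsCycleMinℕ τ (inject₁ i)
  cycleMin⇐ i c j with orbit-τ⊆u i j
  ... | inj₁ (a , e) = subst (λ z → toℕ (inject₁ i) ≤ toℕ z) (sym e) (toℕ-inject₁-≤ (c a))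
  ... | inj₂ (e , _) = subst (λ z → toℕ (inject₁ i) ≤ toℕ z) (sym e) (ℕP.<⇒≤ (inject₁<fromℕ i))

  ¬cycleMin-fromℕ : ¬ IsCycleMinℕ τ (fromℕ n)
  ¬cycleMin-fromℕ c = ℕP.<⇒≱ (subst (λ z → toℕ z < toℕ (fromℕ n)) (sym (insMax-fromℕ u x)) (inject₁<fromℕ (lookup u x))) (c 1)

cycles-insMax-inject₁ : ∀ {n} (u : Vec (Fin n) n) x → IsPerm u → cycles (insMax u (inject₁ x)) ≡ cycles u
cycles-insMax-inject₁ {n} u x pu = ℤP.+-injective (begin
    + cycles τ
  ≡⟨ count-allFin-last n (isCycleMin? τ) ⟩
    ∑ (allFin n) (λ i → 𝟙 (isCycleMin? τ (inject₁ i))) + 𝟙 (isCycleMin? τ (fromℕ n))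
  ≡⟨ cong₂ _+_ (∑-cong (allFin n) (λ i → 𝟙-isCycleMin τ u pτ pu (inject₁ i) i (cycleMin⇒ i) (cycleMin⇐ i)))
               (𝟙-no (isCycleMin? τ (fromℕ n)) (¬cycleMin-fromℕ ∘ IsCycleMin⇒IsCycleMinℕ τ pτ)) ⟩
    ∑ (allFin n) (λ i → 𝟙 (isCycleMin? u i)) + 0ℤ
  ≡⟨ ℤP.+-identityʳ _ ⟩
    ∑ (allFin n) (λ i → 𝟙 (isCycleMin? u i))
  ≡⟨ sym (count≡∑𝟙 (isCycleMin? u) (allFin n)) ⟩
    + cycles u
  ∎)
  where
  open ≡-Reasoning
  open CycleInsertion u x
  pτ : IsPerm τ
  pτ = insMax-perm u (inject₁ x) pu

inject₁-%2 : ∀ {n} (a : Fin n) → toℕ (inject₁ a) % 2 ≡ toℕ a % 2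
inject₁-%2 a = cong (_% 2) (FP.toℕ-inject₁ a)

fromℕ-%2 : ∀ n → toℕ (fromℕ n) % 2 ≡ n % 2
fromℕ-%2 n = cong (_% 2) (FP.toℕ-fromℕ n)

toℕ-%2-cong : ∀ {n} {a b : Fin n} → a ≡ b → toℕ a % 2 ≡ toℕ b % 2
toℕ-%2-cong = cong (λ z → toℕ z % 2)

𝟙-isPA-insMax-fix : ∀ {n} (u : Vec (Fin n) n) → 𝟙 (isPA? (insMax u (fromℕ n))) ≡ 𝟙 (isPA? u)
𝟙-isPA-insMax-fix {n} u = 𝟙-⇔ to from (isPA? (insMax u (fromℕ n))) (isPA? u)
  where
  to : IsPA (insMax u (fromℕ n)) → IsPA u
  to pa j = trans (sym (inject₁-%2 (lookup u j))) (trans (toℕ-%2-cong (sym (insMax-fix-inject₁ u j))) (trans (pa (inject₁ j)) (inject₁-%2 j)))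
  from : IsPA u → IsPA (insMax u (fromℕ n))
  from pa i with view i
  ... | ‵fromℕ = toℕ-%2-cong (insMax-fix-fromℕ u)
  ... | ‵inject₁ j = trans (toℕ-%2-cong (insMax-fix-inject₁ u j)) (trans (inject₁-%2 (lookup u j)) (trans (pa j) (sym (inject₁-%2 j))))

𝟙-isPA-insMax : ∀ {n} (u : Vec (Fin n) n) x p → p ≡ n % 2 →
  𝟙 (isPA? (insMax u (inject₁ x))) ≡ 𝟙 (isPA? u) * 𝟙 (toℕ x % 2 ℕP.≟ p)
𝟙-isPA-insMax {n} u x p refl = trans (𝟙-⇔ to from (isPA? (insMax u (inject₁ x))) (isPA? u ×-dec (toℕ x % 2 ℕP.≟ p)))
                                     (𝟙-× (isPA? u) (toℕ x % 2 ℕP.≟ p))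
  where
  to : IsPA (insMax u (inject₁ x)) → IsPA u × toℕ x % 2 ≡ n % 2
  to pa = pu , x≡n
    where
    x≡n : toℕ x % 2 ≡ n % 2
    x≡n = trans (sym (inject₁-%2 x)) (trans (sym (pa (inject₁ x))) (trans (toℕ-%2-cong (insMax-at u x)) (fromℕ-%2 n)))
    pu : IsPA u
    pu j with j FP.≟ x
    ... | yes refl = trans (sym (inject₁-%2 (lookup u j))) (trans (toℕ-%2-cong (sym (insMax-fromℕ u j)))
                       (trans (pa (fromℕ n)) (trans (fromℕ-%2 n) (sym x≡n))))
    ... | no j≢x = trans (sym (inject₁-%2 (lookup u j))) (trans (toℕ-%2-cong (sym (insMax-other u x j j≢x)))
                     (trans (pa (inject₁ j)) (inject₁-%2 j)))
  from : IsPA u × toℕ x % 2 ≡ n % 2 → IsPA (insMax u (inject₁ x))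
  from (pa , x≡n) i with view i
  ... | ‵fromℕ = trans (toℕ-%2-cong (insMax-fromℕ u x)) (trans (inject₁-%2 (lookup u x)) (trans (pa x) (trans x≡n (sym (fromℕ-%2 n)))))
  ... | ‵inject₁ j with j FP.≟ x
  ...   | yes refl = trans (toℕ-%2-cong (insMax-at u j)) (trans (fromℕ-%2 n) (trans (sym x≡n) (sym (inject₁-%2 j))))
  ...   | no j≢x = trans (toℕ-%2-cong (insMax-other u x j j≢x)) (trans (inject₁-%2 (lookup u j)) (trans (pa j) (sym (inject₁-%2 j))))

isFixed : ∀ {n} → Vec (Fin n) n → Fin n → Bool
isFixed σ i = does (lookup σ i FP.≟ i)

FixedSet : ∀ {n} → Vec (Fin n) n → (Fin n → Bool) → Set
FixedSet σ S = ∀ i → isFixed σ i ≡ S i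

fixedSet? : ∀ {n} (σ : Vec (Fin n) n) (S : Fin n → Bool) → Dec (FixedSet σ S)
fixedSet? σ S = FP.all? (λ i → isFixed σ i BP.≟ S i)

withFixed : ∀ {n} → (Fin n → Bool) → Fin n → Fin n → Bool
withFixed S x = updateAt S x (const true)

isFixed-inject₁ : ∀ {n} (τ : Vec (Fin (suc n)) (suc n)) (u : Vec (Fin n) n) j →
  lookup τ (inject₁ j) ≡ inject₁ (lookup u j) → isFixed τ (inject₁ j) ≡ isFixed u j
isFixed-inject₁ τ u j e = trans (cong (λ z → does (z FP.≟ inject₁ j)) e)
  (does-⇔ (mk⇔ FP.inject₁-injective (cong inject₁)) (inject₁ (lookup u j) FP.≟ inject₁ j) (lookup u j FP.≟ j))

isFixed-insMax-fix : ∀ {n} (u : Vec (Fin n) n) → isFixed (insMax u (fromℕ n)) (fromℕ n) ≡ true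
isFixed-insMax-fix {n} u = dec-true (lookup (insMax u (fromℕ n)) (fromℕ n) FP.≟ fromℕ n) (insMax-fix-fromℕ u)

isFixed-insMax-fromℕ : ∀ {n} (u : Vec (Fin n) n) x → isFixed (insMax u (inject₁ x)) (fromℕ n) ≡ false
isFixed-insMax-fromℕ {n} u x = dec-false (lookup (insMax u (inject₁ x)) (fromℕ n) FP.≟ fromℕ n)
  (λ e → inject₁≢fromℕ (lookup u x) (trans (sym (insMax-fromℕ u x)) e))

isFixed-insMax-at : ∀ {n} (u : Vec (Fin n) n) x → isFixed (insMax u (inject₁ x)) (inject₁ x) ≡ false
isFixed-insMax-at u x = dec-false (lookup (insMax u (inject₁ x)) (inject₁ x) FP.≟ inject₁ x)
  (λ e → FP.fromℕ≢inject₁ (trans (sym (insMax-at u x)) e))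

𝟙-fixedSet-insMax-fix : ∀ {n} (u : Vec (Fin n) n) (S : Fin (suc n) → Bool) →
  𝟙 (fixedSet? (insMax u (fromℕ n)) S) ≡ 𝟙 (S (fromℕ n) BP.≟ true) * 𝟙 (fixedSet? u (S ∘ inject₁))
𝟙-fixedSet-insMax-fix {n} u S = trans (𝟙-⇔ to from (fixedSet? (insMax u (fromℕ n)) S) ((S (fromℕ n) BP.≟ true) ×-dec fixedSet? u (S ∘ inject₁)))
                                   (𝟙-× (S (fromℕ n) BP.≟ true) (fixedSet? u (S ∘ inject₁)))
  where
  fixed-inject₁ : ∀ j → isFixed (insMax u (fromℕ n)) (inject₁ j) ≡ isFixed u j
  fixed-inject₁ j = isFixed-inject₁ (insMax u (fromℕ n)) u j (insMax-fix-inject₁ u j)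
  to : FixedSet (insMax u (fromℕ n)) S → S (fromℕ n) ≡ true × FixedSet u (S ∘ inject₁)
  to h = trans (sym (h (fromℕ n))) (isFixed-insMax-fix u) , λ j → trans (sym (fixed-inject₁ j)) (h (inject₁ j))
  from : S (fromℕ n) ≡ true × FixedSet u (S ∘ inject₁) → FixedSet (insMax u (fromℕ n)) S
  from (Sn , h) i with view i
  ... | ‵fromℕ = trans (isFixed-insMax-fix u) (sym Sn)
  ... | ‵inject₁ j = trans (fixed-inject₁ j) (h j)

-- The first summand is the case where x is fixed by u, i.e. the result has the 2-cycle (x n).
𝟙-fixedSet-insMax : ∀ {n} (u : Vec (Fin n) n) x (S : Fin (suc n) → Bool) →
  𝟙 (fixedSet? (insMax u (inject₁ x)) S) ≡
    𝟙 (S (fromℕ n) BP.≟ false) * (𝟙 (S (inject₁ x) BP.≟ false) *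
      (𝟙 (fixedSet? u (withFixed (S ∘ inject₁) x)) + 𝟙 (fixedSet? u (S ∘ inject₁))))
𝟙-fixedSet-insMax {n} u x S with S (fromℕ n) BP.≟ false | S (inject₁ x) BP.≟ false
... | no Sn≢false | _ = 𝟙-no (fixedSet? (insMax u (inject₁ x)) S) (λ h → Sn≢false (trans (sym (h (fromℕ n))) (isFixed-insMax-fromℕ u x)))
... | yes _ | no Sx≢false = trans (𝟙-no (fixedSet? (insMax u (inject₁ x)) S) (λ h → Sx≢false (trans (sym (h (inject₁ x))) (isFixed-insMax-at u x))))
                                       (sym (ℤP.*-zeroˡ (𝟙 (fixedSet? u (withFixed (S ∘ inject₁) x)) + 𝟙 (fixedSet? u (S ∘ inject₁)))))
... | yes Sn≡false | yes Sx≡false =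
  trans (𝟙-⊎ to from disjoint (fixedSet? (insMax u (inject₁ x)) S) (fixedSet? u (withFixed S₀ x)) (fixedSet? u S₀))
        (sym (trans (ℤP.*-identityˡ _) (ℤP.*-identityˡ _)))
  where
  S₀ : Fin n → Bool
  S₀ = S ∘ inject₁
  fixed-other : ∀ j → j ≢ x → isFixed (insMax u (inject₁ x)) (inject₁ j) ≡ isFixed u j
  fixed-other j j≢x = isFixed-inject₁ (insMax u (inject₁ x)) u j (insMax-other u x j j≢x)
  to : FixedSet (insMax u (inject₁ x)) S → FixedSet u (withFixed S₀ x) ⊎ FixedSet u S₀
  to h with isFixed u x in ux
  ... | true = inj₁ agree
    where
    agree : ∀ j → isFixed u j ≡ withFixed S₀ x j
    agree j with j FP.≟ x
    ... | yes refl = trans ux (sym (updateAt-updates j S₀))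
    ... | no j≢x = trans (sym (fixed-other j j≢x)) (trans (h (inject₁ j)) (sym (updateAt-minimal j x S₀ j≢x)))
  ... | false = inj₂ agree
    where
    agree : ∀ j → isFixed u j ≡ S₀ j
    agree j with j FP.≟ x
    ... | yes refl = trans ux (sym Sx≡false)
    ... | no j≢x = trans (sym (fixed-other j j≢x)) (h (inject₁ j))
  from : FixedSet u (withFixed S₀ x) ⊎ FixedSet u S₀ → FixedSet (insMax u (inject₁ x)) S
  from h i with view i
  ... | ‵fromℕ = trans (isFixed-insMax-fromℕ u x) (sym Sn≡false)
  ... | ‵inject₁ j with j FP.≟ x
  ...   | yes refl = trans (isFixed-insMax-at u j) (sym Sx≡false)
  ...   | no j≢x with h
  ...     | inj₁ h₁ = trans (fixed-other j j≢x) (trans (h₁ j) (updateAt-minimal j x S₀ j≢x))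
  ...     | inj₂ h₀ = trans (fixed-other j j≢x) (h₀ j)
  disjoint : FixedSet u (withFixed S₀ x) → FixedSet u S₀ → ⊥
  disjoint h₁ h₀ with trans (sym (trans (h₁ x) (updateAt-updates x S₀))) (trans (h₀ x) Sx≡false)
  ... | ()

excAt? : ∀ {n} (b : ℕ) (σ : Vec (Fin n) n) (i : Fin n) → Dec (toℕ i % 2 ≡ b × toℕ i < toℕ (lookup σ i))
excAt? b σ i = (toℕ i % 2 ℕP.≟ b) ×-dec (toℕ i <? toℕ (lookup σ i))

exc : ∀ {n} → ℕ → Vec (Fin n) n → ℕ
exc {n} b σ = count (excAt? b σ) (allFin n)

𝟙-excAt-fromℕ : ∀ {n} b (τ : Vec (Fin (suc n)) (suc n)) → 𝟙 (excAt? b τ (fromℕ n)) ≡ 0ℤ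
𝟙-excAt-fromℕ {n} b τ = 𝟙-no (excAt? b τ (fromℕ n)) (λ (_ , n<τn) →
  ℕP.<⇒≱ n<τn (subst (toℕ (lookup τ (fromℕ n)) ≤_) (sym (FP.toℕ-fromℕ n)) (ℕP.≤-pred (FP.toℕ<n (lookup τ (fromℕ n))))))

𝟙-excAt-inject₁ : ∀ {n} b (τ : Vec (Fin (suc n)) (suc n)) (u : Vec (Fin n) n) j →
  lookup τ (inject₁ j) ≡ inject₁ (lookup u j) → 𝟙 (excAt? b τ (inject₁ j)) ≡ 𝟙 (excAt? b u j)
𝟙-excAt-inject₁ b τ u j e = 𝟙-⇔
  (λ (p , l) → trans (sym (inject₁-%2 j)) p , subst₂ _<_ (FP.toℕ-inject₁ j) (trans (cong toℕ e) (FP.toℕ-inject₁ _)) l)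
  (λ (p , l) → trans (inject₁-%2 j) p , subst₂ _<_ (sym (FP.toℕ-inject₁ j)) (sym (trans (cong toℕ e) (FP.toℕ-inject₁ _))) l) _ _

exc-insMax-fix : ∀ {n} b (u : Vec (Fin n) n) → exc b (insMax u (fromℕ n)) ≡ exc b u
exc-insMax-fix {n} b u = ℤP.+-injective (begin
    + exc b τ
  ≡⟨ count-allFin-last n (excAt? b τ) ⟩
    ∑ (allFin n) (λ j → 𝟙 (excAt? b τ (inject₁ j))) + 𝟙 (excAt? b τ (fromℕ n))
  ≡⟨ cong₂ _+_ (∑-cong (allFin n) (λ j → 𝟙-excAt-inject₁ b τ u j (insMax-fix-inject₁ u j))) (𝟙-excAt-fromℕ b τ) ⟩
    ∑ (allFin n) (λ j → 𝟙 (excAt? b u j)) + 0ℤ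
  ≡⟨ ℤP.+-identityʳ _ ⟩
    ∑ (allFin n) (λ j → 𝟙 (excAt? b u j))
  ≡⟨ sym (count≡∑𝟙 (excAt? b u) (allFin n)) ⟩
    + exc b u
  ∎)
  where
  open ≡-Reasoning
  τ : Vec (Fin (suc n)) (suc n)
  τ = insMax u (fromℕ n)

-- Position x becomes an excedance (value n) and n itself never is; all other positions keep their status.
exc-insMax : ∀ {n} b (u : Vec (Fin n) n) x →
  + exc b (insMax u (inject₁ x)) + 𝟙 (excAt? b u x) ≡ + exc b u + 𝟙 (toℕ x % 2 ℕP.≟ b)
exc-insMax {n} b u x = begin
    + exc b τ + 𝟙 (excAt? b u x)
  ≡⟨ cong (_+ 𝟙 (excAt? b u x)) (trans (count-allFin-last n (excAt? b τ))
       (trans (cong (_+_ (∑ (allFin n) excτ)) (𝟙-excAt-fromℕ b τ)) (ℤP.+-identityʳ (∑ (allFin n) excτ)))) ⟩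
    ∑ (allFin n) excτ + 𝟙 (excAt? b u x)
  ≡⟨ ∑-allFin-swapAt excτ (λ j → 𝟙 (excAt? b u j)) x (λ j j≢x → 𝟙-excAt-inject₁ b τ u j (insMax-other u x j j≢x)) ⟩
    ∑ (allFin n) (λ j → 𝟙 (excAt? b u j)) + excτ x
  ≡⟨ cong₂ _+_ (sym (count≡∑𝟙 (excAt? b u) (allFin n))) excτ-x ⟩
    + exc b u + 𝟙 (toℕ x % 2 ℕP.≟ b)
  ∎
  where
  open ≡-Reasoning
  τ : Vec (Fin (suc n)) (suc n)
  τ = insMax u (inject₁ x)
  excτ : Fin n → ℤ
  excτ j = 𝟙 (excAt? b τ (inject₁ j))
  excτ-x : excτ x ≡ 𝟙 (toℕ x % 2 ℕP.≟ b)
  excτ-x = 𝟙-⇔ (λ (p , _) → trans (sym (inject₁-%2 x)) p)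
               (λ p → trans (inject₁-%2 x) p , subst (λ z → toℕ (inject₁ x) < toℕ z) (sym (insMax-at u x)) (inject₁<fromℕ x)) _ _

sign : ∀ {n} → Vec (Fin n) n → ℤ
sign {n} σ = negOnePow (n ∸ cycles σ)

cycles≤n : ∀ {n} (σ : Vec (Fin n) n) → cycles σ ≤ n
cycles≤n {n} σ = subst (cycles σ ≤_) (LP.length-tabulate {n = n} id) (LP.length-filter (isCycleMin? σ) (allFin n))

sign-insMax-fix : ∀ {n} (u : Vec (Fin n) n) → IsPerm u → sign (insMax u (fromℕ n)) ≡ sign u
sign-insMax-fix u pu = cong (λ c → negOnePow (suc _ ∸ c)) (cycles-insMax-fix u pu)

sign-insMax : ∀ {n} (u : Vec (Fin n) n) x → IsPerm u → sign (insMax u (inject₁ x)) ≡ - sign u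
sign-insMax {n} u x pu = cong negOnePow (trans (cong (suc n ∸_) (cycles-insMax-inject₁ u x pu)) (ℕP.+-∸-assoc 1 (cycles≤n u)))

∑₁ : ℕ → (ℕ → ℤ) → ℤ
∑₁ zero f = 0ℤ
∑₁ (suc r) f = ∑₁ r f + f (suc r)

-- D r f is the signed excedance enumerator ∑ sign(δ) f(exc δ) over the derangements δ of [r].
D : ℕ → (ℕ → ℤ) → ℤ
D zero f = f 0
D (suc r) f = negOnePow r * ∑₁ r f

∑₁-scaled : ∀ m c (h : ℕ → ℤ) → ∑₁ m (λ e → (c - + e) * h e) ≡ c * ∑₁ m h - ∑₁ m (λ e → + e * h e)
∑₁-scaled zero c h = lem c
  where
  lem : ∀ c → 0ℤ ≡ c * 0ℤ - 0ℤ
  lem = solve-∀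
∑₁-scaled (suc m) c h rewrite ∑₁-scaled m c h = lem c (∑₁ m h) (∑₁ m (λ e → + e * h e)) (+ suc m) (h (suc m))
  where
  lem : ∀ c T U e x → (c * T - U) + (c - e) * x ≡ c * (T + x) - (U + e * x)
  lem = solve-∀

∑₁-by-parts : ∀ m (f : ℕ → ℤ) → ∑₁ m (λ e → + e * f e) - ∑₁ m (λ e → + e * f (suc e)) ≡ ∑₁ m f - + m * f (suc m)
∑₁-by-parts zero f = lem (f 1)
  where
  lem : ∀ x → 0ℤ - 0ℤ ≡ 0ℤ - 0ℤ * x
  lem = solve-∀
∑₁-by-parts (suc m) f = begin
    (A + (1ℤ + M) * x) - (B + (1ℤ + M) * y)
  ≡⟨ l₁ A B M x y ⟩
    (A - B) + ((1ℤ + M) * x - (1ℤ + M) * y)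
  ≡⟨ cong (_+ ((1ℤ + M) * x - (1ℤ + M) * y)) (∑₁-by-parts m f) ⟩
    (∑₁ m f - M * x) + ((1ℤ + M) * x - (1ℤ + M) * y)
  ≡⟨ l₂ (∑₁ m f) M x y ⟩
    (∑₁ m f + x) - (1ℤ + M) * y
  ∎
  where
  open ≡-Reasoning
  A B M x y : ℤ
  A = ∑₁ m (λ e → + e * f e)
  B = ∑₁ m (λ e → + e * f (suc e))
  M = + m
  x = f (suc m)
  y = f (suc (suc m))
  l₁ : ∀ A B M x y → (A + (1ℤ + M) * x) - (B + (1ℤ + M) * y) ≡ (A - B) + ((1ℤ + M) * x - (1ℤ + M) * y)
  l₁ = solve-∀
  l₂ : ∀ T M x y → (T - M * x) + ((1ℤ + M) * x - (1ℤ + M) * y) ≡ (T + x) - (1ℤ + M) * y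
  l₂ = solve-∀

-- The derangement recurrence refined by excedances: the new maximum forms a 2-cycle with one of
-- r points (one new excedance), or is inserted into a cycle after an excedance (none) or after a
-- non-excedance (one).
D-suc : ∀ r (f : ℕ → ℤ) →
  D (suc r) f ≡ - (D r (λ e → + e * f e) + D r (λ e → (+ r - + e) * f (suc e)) + + r * D (r ∸ 1) (f ∘ suc))
D-suc zero f = lem (f 0) (f 1)
  where
  lem : ∀ a b → 1ℤ * 0ℤ ≡ - (0ℤ * a + (0ℤ - 0ℤ) * b + 0ℤ * b)
  lem = solve-∀
D-suc (suc zero) f = lem (f 1)
  where
  lem : ∀ a → - 1ℤ * (0ℤ + a) ≡ - (1ℤ * 0ℤ + 1ℤ * 0ℤ + 1ℤ * a)
  lem = solve-∀
D-suc (suc (suc t)) f = begin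
    - (- N) * (V + x)
  ≡⟨ l₁ N V M x ⟩
    N * ((V - M * x) + (1ℤ + M) * x)
  ≡⟨ cong (λ z → N * (z + (1ℤ + M) * x)) (sym (∑₁-by-parts (suc t) f)) ⟩
    N * ((P - Q) + (1ℤ + M) * x)
  ≡⟨ l₂ N P Q U M x ⟩
    - ((- N) * P + (- N) * ((1ℤ + M) * (U + x) - Q) + (1ℤ + M) * (N * U))
  ≡⟨ cong (λ z → - ((- N) * P + (- N) * z + (1ℤ + M) * (N * U))) (sym (∑₁-scaled (suc t) (+ suc (suc t)) (f ∘ suc))) ⟩
    - (D (suc (suc t)) (λ e → + e * f e) + D (suc (suc t)) (λ e → (+ suc (suc t) - + e) * f (suc e))
       + + suc (suc t) * D (suc t) (f ∘ suc))
  ∎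
  where
  open ≡-Reasoning
  N V x M P Q U : ℤ
  N = negOnePow t
  V = ∑₁ (suc t) f
  x = f (suc (suc t))
  M = + suc t
  P = ∑₁ (suc t) (λ e → + e * f e)
  Q = ∑₁ (suc t) (λ e → + e * f (suc e))
  U = ∑₁ t (f ∘ suc)
  l₁ : ∀ N V M x → - (- N) * (V + x) ≡ N * ((V - M * x) + (1ℤ + M) * x)
  l₁ = solve-∀
  l₂ : ∀ N P Q U M x → N * ((P - Q) + (1ℤ + M) * x) ≡ - ((- N) * P + (- N) * ((1ℤ + M) * (U + x) - Q) + (1ℤ + M) * (N * U))
  l₂ = solve-∀

weight : ∀ {n} (p q : ℕ) (S : Fin n → Bool) (f g : ℕ → ℤ) → Vec (Fin n) n → ℤ
weight p q S f g v = 𝟙 (isPA? v) * (𝟙 (fixedSet? v S) * (f (exc p v) * (g (exc q v) * sign v)))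

-- Q is the generating function of the parity alternating permutations with fixed-point set S,
-- by sign and by the numbers of excedances at positions of parity p and of parity q.
Q : ∀ n (p q : ℕ) (S : Fin n → Bool) (f g : ℕ → ℤ) → ℤ
Q n p q S f g = ∑Perm n (weight p q S f g)

free : ∀ {n} → ℕ → (Fin n → Bool) → ℕ
free {n} p S = count (λ i → (toℕ i % 2 ℕP.≟ p) ×-dec (S i BP.≟ false)) (allFin n)

free≡∑ : ∀ {n} p (S : Fin n → Bool) → + free p S ≡ ∑ (allFin n) (λ x → 𝟙 (toℕ x % 2 ℕP.≟ p) * 𝟙 (S x BP.≟ false))
free≡∑ {n} p S = trans (count≡∑𝟙 _ (allFin n)) (∑-cong (allFin n) (λ x → 𝟙-× (toℕ x % 2 ℕP.≟ p) (S x BP.≟ false)))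

*-weight : ∀ {n} p q (S : Fin n → Bool) f g u c (h : ℕ → ℤ) → (FixedSet u S → c ≡ h (exc p u)) →
  c * weight p q S f g u ≡ weight p q S (λ e → h e * f e) g u
*-weight p q S f g u c h c≡h with fixedSet? u S
... | no _ = lem c (𝟙 (isPA? u)) (f (exc p u) * (g (exc q u) * sign u))
  where
  lem : ∀ c a w → c * (a * (0ℤ * w)) ≡ a * 0ℤ
  lem = solve-∀
... | yes fix rewrite c≡h fix = lem (h (exc p u)) (𝟙 (isPA? u)) (f (exc p u)) (g (exc q u) * sign u)
  where
  lem : ∀ c a φ w → c * (a * (1ℤ * (φ * w))) ≡ a * (1ℤ * ((c * φ) * w))
  lem = solve-∀

∑Perm-+ : ∀ n (v w : Vec (Fin n) n → ℤ) → ∑Perm n (λ u → v u + w u) ≡ ∑Perm n v + ∑Perm n w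
∑Perm-+ n v w = trans (∑-cong (words n n) (λ u → ℤP.*-distribˡ-+ (𝟙 (isPerm? u)) (v u) (w u))) (∑-+ (words n n) _ _)

∑Perm-*ˡ : ∀ n c (w : Vec (Fin n) n → ℤ) → ∑Perm n (λ u → c * w u) ≡ c * ∑Perm n w
∑Perm-*ˡ n c w = trans (∑-cong (words n n) (λ u → lem (𝟙 (isPerm? u)) c (w u))) (∑-*ˡ (words n n) c _)
  where
  lem : ∀ a c w → a * (c * w) ≡ c * (a * w)
  lem = solve-∀

∑Perm-neg : ∀ n (w : Vec (Fin n) n → ℤ) → ∑Perm n (λ u → - w u) ≡ - ∑Perm n w
∑Perm-neg n w = trans (∑-cong (words n n) (λ u → sym (ℤP.neg-distribʳ-* (𝟙 (isPerm? u)) (w u)))) (∑-neg (words n n) _)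

∑Perm-∑ : ∀ {A : Set} n (xs : List A) (c : A → ℤ) (w : A → Vec (Fin n) n → ℤ) →
  ∑Perm n (λ u → ∑ xs (λ x → c x * w x u)) ≡ ∑ xs (λ x → c x * ∑Perm n (w x))
∑Perm-∑ n xs c w = begin
    ∑ (words n n) (λ u → 𝟙 (isPerm? u) * ∑ xs (λ x → c x * w x u))
  ≡⟨ ∑-cong (words n n) (λ u → trans (sym (∑-*ˡ xs (𝟙 (isPerm? u)) _)) (∑-cong xs (λ x → lem (𝟙 (isPerm? u)) (c x) (w x u)))) ⟩
    ∑ (words n n) (λ u → ∑ xs (λ x → c x * (𝟙 (isPerm? u) * w x u)))
  ≡⟨ ∑-comm (words n n) xs _ ⟩
    ∑ xs (λ x → ∑ (words n n) (λ u → c x * (𝟙 (isPerm? u) * w x u)))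
  ≡⟨ ∑-cong xs (λ x → ∑-*ˡ (words n n) (c x) _) ⟩
    ∑ xs (λ x → c x * ∑Perm n (w x))
  ∎
  where
  open ≡-Reasoning
  lem : ∀ a c w → a * (c * w) ≡ c * (a * w)
  lem = solve-∀

∑-affine : ∀ {A : Set} (xs : List A) (l v w : ℤ) (a b c : A → ℤ) →
  ∑ xs (λ x → l * - (a x + b x * v + c x * w)) ≡ l * - (∑ xs a + ∑ xs b * v + ∑ xs c * w)
∑-affine [] l v w a b c = lem l v w
  where
  lem : ∀ l v w → 0ℤ ≡ l * - (0ℤ + 0ℤ * v + 0ℤ * w)
  lem = solve-∀
∑-affine (y ∷ xs) l v w a b c rewrite ∑-affine xs l v w a b c = lem l v w (a y) (b y) (c y) (∑ xs a) (∑ xs b) (∑ xs c)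
  where
  lem : ∀ l v w a b c A B C →
    l * - (a + b * v + c * w) + l * - (A + B * v + C * w) ≡ l * - ((a + A) + (b + B) * v + (c + C) * w)
  lem = solve-∀

module Insertion {n : ℕ} (p q : ℕ) (p≡n : p ≡ n % 2) (q≢p : q ≢ p) (S : Fin (suc n) → Bool) (f g : ℕ → ℤ) where
  S₀ : Fin n → Bool
  S₀ = S ∘ inject₁

  T L : ℤ
  T = 𝟙 (S (fromℕ n) BP.≟ true)
  L = 𝟙 (S (fromℕ n) BP.≟ false)

  X Z : Fin n → ℤ
  X x = 𝟙 (toℕ x % 2 ℕP.≟ p)
  Z x = 𝟙 (S₀ x BP.≟ false)

  -- n is a fixed point (T), or it is inserted after a non-fixed x of parity p (L): x is either
  -- fixed in u (the 2-cycle (x n) adds an excedance), or an excedance of u (e ↦ e), or not (e ↦ e + 1).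
  recurrence : ((Fin n → Bool) → (ℕ → ℤ) → ℤ) → ℤ
  recurrence W = T * W S₀ f + L * - (∑ (allFin n) (λ x → (X x * Z x) * W (withFixed S₀ x) (f ∘ suc))
                                     + W S₀ (λ e → + e * f e) + W S₀ (λ e → (+ free p S₀ - + e) * f (suc e)))

  module _ (u : Vec (Fin n) n) (pu : IsPerm u) where
    W : (Fin n → Bool) → (ℕ → ℤ) → ℤ
    W S' f' = weight p q S' f' g u

    weight-insMax-fix : weight p q S f g (insMax u (fromℕ n)) ≡ T * W S₀ f
    weight-insMax-fix = begin
        weight p q S f g (insMax u (fromℕ n))
      ≡⟨ cong₂ _*_ (𝟙-isPA-insMax-fix u) (cong₂ _*_ (𝟙-fixedSet-insMax-fix u S)
           (cong₂ _*_ (cong f (exc-insMax-fix p u)) (cong₂ _*_ (cong g (exc-insMax-fix q u)) (sign-insMax-fix u pu)))) ⟩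
        𝟙 (isPA? u) * ((T * 𝟙 (fixedSet? u S₀)) * (f (exc p u) * (g (exc q u) * sign u)))
      ≡⟨ lem (𝟙 (isPA? u)) T (𝟙 (fixedSet? u S₀)) (f (exc p u) * (g (exc q u) * sign u)) ⟩
        T * W S₀ f
      ∎
      where
      open ≡-Reasoning
      lem : ∀ a t b w → a * ((t * b) * w) ≡ t * (a * (b * w))
      lem = solve-∀

    module _ (x : Fin n) where
      τ : Vec (Fin (suc n)) (suc n)
      τ = insMax u (inject₁ x)

      E : ℤ
      E = 𝟙 (excAt? p u x)

      exc-q-insMax : toℕ x % 2 ≡ p → exc q τ ≡ exc q u
      exc-q-insMax x≡p = ℤP.+-injective (trans (sym (ℤP.+-identityʳ _)) (trans
        (cong (_+_ (+ exc q τ)) (sym (𝟙-no (excAt? q u x) (λ (x≡q , _) → q≢p (trans (sym x≡q) x≡p)))))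
        (trans (exc-insMax q u x) (trans (cong (_+_ (+ exc q u)) (𝟙-no (toℕ x % 2 ℕP.≟ q) (λ x≡q → q≢p (trans (sym x≡q) x≡p))))
                                         (ℤP.+-identityʳ _)))))

      f-exc-p-insMax : toℕ x % 2 ≡ p → f (exc p τ) ≡ E * f (exc p u) + (1ℤ - E) * f (suc (exc p u))
      f-exc-p-insMax x≡p = by-excAt (excAt? p u x)
        (trans (exc-insMax p u x) (cong (_+_ (+ exc p u)) (𝟙-yes (toℕ x % 2 ℕP.≟ p) x≡p)))
        where
        by-excAt : (d : Dec _) → + exc p τ + 𝟙 d ≡ + exc p u + 1ℤ →
          f (exc p τ) ≡ 𝟙 d * f (exc p u) + (1ℤ - 𝟙 d) * f (suc (exc p u))
        by-excAt (yes _) e = trans (cong f (ℕP.+-cancelʳ-≡ 1 _ _ (ℤP.+-injective e))) (lem (f (exc p u)) (f (suc (exc p u))))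
          where
          lem : ∀ a b → a ≡ 1ℤ * a + (1ℤ - 1ℤ) * b
          lem = solve-∀
        by-excAt (no _) e = trans (cong f (trans (sym (ℕP.+-identityʳ _)) (trans (ℤP.+-injective e) (ℕP.+-comm (exc p u) 1))))
                                  (lem (f (exc p u)) (f (suc (exc p u))))
          where
          lem : ∀ a b → b ≡ 0ℤ * a + (1ℤ - 0ℤ) * b
          lem = solve-∀

      fixed⇒¬excAt : 𝟙 (fixedSet? u (withFixed S₀ x)) * E ≡ 0ℤ
      fixed⇒¬excAt with fixedSet? u (withFixed S₀ x) | excAt? p u x
      ... | yes fix | yes (_ , x<ux) = ⊥-elim (ℕP.<-irrefl (cong toℕ (sym ux≡x)) x<ux)
        where
        ux≡x : lookup u x ≡ x
        ux≡x with lookup u x FP.≟ x | trans (fix x) (updateAt-updates x S₀)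
        ... | yes e | _ = e
        ... | no _ | ()
      ... | yes _ | no _ = refl
      ... | no _ | _ = refl

      contribution : ℤ → ℤ
      contribution χ = L * - ((χ * Z x) * W (withFixed S₀ x) (f ∘ suc) + (χ * (Z x * E)) * W S₀ f + (χ * (Z x * (1ℤ - E))) * W S₀ (f ∘ suc))

      weight-insMax : weight p q S f g τ ≡ contribution (X x)
      weight-insMax = by-parity (toℕ x % 2 ℕP.≟ p)
        where
        by-parity : (d : Dec (toℕ x % 2 ≡ p)) → weight p q S f g τ ≡ contribution (𝟙 d)
        by-parity (no x≢p) = begin
            weight p q S f g τ
          ≡⟨ cong (_* (𝟙 (fixedSet? τ S) * (f (exc p τ) * (g (exc q τ) * sign τ))))
                  (trans (𝟙-isPA-insMax u x p p≡n) (cong (𝟙 (isPA? u) *_) (𝟙-no (toℕ x % 2 ℕP.≟ p) x≢p))) ⟩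
            (𝟙 (isPA? u) * 0ℤ) * (𝟙 (fixedSet? τ S) * (f (exc p τ) * (g (exc q τ) * sign τ)))
          ≡⟨ lem (𝟙 (isPA? u)) _ L (Z x) (W (withFixed S₀ x) (f ∘ suc)) E (W S₀ f) (W S₀ (f ∘ suc)) ⟩
            contribution 0ℤ
          ∎
          where
          open ≡-Reasoning
          lem : ∀ a w l z w₁ e w₂ w₃ → (a * 0ℤ) * w ≡ l * - ((0ℤ * z) * w₁ + (0ℤ * (z * e)) * w₂ + (0ℤ * (z * (1ℤ - e))) * w₃)
          lem = solve-∀
        by-parity (yes x≡p) = begin
            weight p q S f g τ
          ≡⟨ cong₂ _*_ (trans (𝟙-isPA-insMax u x p p≡n) (cong (A *_) (𝟙-yes (toℕ x % 2 ℕP.≟ p) x≡p)))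
               (cong₂ _*_ (𝟙-fixedSet-insMax u x S) (cong₂ _*_ (f-exc-p-insMax x≡p) (cong₂ _*_ (cong g (exc-q-insMax x≡p)) (sign-insMax u x pu)))) ⟩
            (A * 1ℤ) * ((L * (Z x * (B₁ + B₀))) * ((E * fₑ + (1ℤ - E) * fₛ) * (G * - s)))
          ≡⟨ lem A L (Z x) B₁ B₀ E fₑ fₛ G s ⟩
            R + (B₁ * E) * (A * L * Z x * G * s * (fₛ - fₑ))
          ≡⟨ cong (λ z → R + z * (A * L * Z x * G * s * (fₛ - fₑ))) fixed⇒¬excAt ⟩
            R + 0ℤ * (A * L * Z x * G * s * (fₛ - fₑ))
          ≡⟨ trans (cong (_+_ R) (ℤP.*-zeroˡ (A * L * Z x * G * s * (fₛ - fₑ)))) (ℤP.+-identityʳ R) ⟩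
            contribution 1ℤ
          ∎
          where
          open ≡-Reasoning
          A B₁ B₀ fₑ fₛ G s R : ℤ
          A = 𝟙 (isPA? u)
          B₁ = 𝟙 (fixedSet? u (withFixed S₀ x))
          B₀ = 𝟙 (fixedSet? u S₀)
          fₑ = f (exc p u)
          fₛ = f (suc (exc p u))
          G = g (exc q u)
          s = sign u
          R = contribution 1ℤ
          lem : ∀ a l z b₁ b₀ e fₑ fₛ γ s →
            (a * 1ℤ) * ((l * (z * (b₁ + b₀))) * ((e * fₑ + (1ℤ - e) * fₛ) * (γ * - s)))
            ≡ l * - ((1ℤ * z) * (a * (b₁ * (fₛ * (γ * s)))) + (1ℤ * (z * e)) * (a * (b₀ * (fₑ * (γ * s))))
                     + (1ℤ * (z * (1ℤ - e))) * (a * (b₀ * (fₛ * (γ * s))))) + (b₁ * e) * (a * l * z * γ * s * (fₛ - fₑ))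
          lem = solve-∀

    ∑excAt : FixedSet u S₀ → ∑ (allFin n) (λ x → X x * (Z x * E x)) ≡ + exc p u
    ∑excAt fix = trans (∑-cong (allFin n) excAt⇒free) (sym (count≡∑𝟙 (excAt? p u) (allFin n)))
      where
      excAt⇒free : ∀ x → X x * (Z x * E x) ≡ E x
      excAt⇒free x with excAt? p u x
      ... | no _ = trans (cong (X x *_) (ℤP.*-zeroʳ (Z x))) (ℤP.*-zeroʳ (X x))
      ... | yes (x≡p , x<ux) rewrite 𝟙-yes (toℕ x % 2 ℕP.≟ p) x≡p
                                    | 𝟙-yes (S₀ x BP.≟ false) (trans (sym (fix x)) (dec-false (lookup u x FP.≟ x)
                                                                       (λ ux≡x → ℕP.<-irrefl (cong toℕ (sym ux≡x)) x<ux))) = refl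

    ∑¬excAt : FixedSet u S₀ → ∑ (allFin n) (λ x → X x * (Z x * (1ℤ - E x))) ≡ + free p S₀ - + exc p u
    ∑¬excAt fix = begin
        ∑ (allFin n) (λ x → X x * (Z x * (1ℤ - E x)))
      ≡⟨ ∑-cong (allFin n) (λ x → lem (X x) (Z x) (E x)) ⟩
        ∑ (allFin n) (λ x → X x * Z x - X x * (Z x * E x))
      ≡⟨ ∑-sub (allFin n) (λ x → X x * Z x) (λ x → X x * (Z x * E x)) ⟩
        ∑ (allFin n) (λ x → X x * Z x) - ∑ (allFin n) (λ x → X x * (Z x * E x))
      ≡⟨ cong₂ _-_ (sym (free≡∑ p S₀)) (∑excAt fix) ⟩
        + free p S₀ - + exc p u
      ∎
      where
      open ≡-Reasoning
      lem : ∀ a b c → a * (b * (1ℤ - c)) ≡ a * b - a * (b * c)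
      lem = solve-∀

    ∑-weight-insMax : ∑ (allFin (suc n)) (λ x → weight p q S f g (insMax u x)) ≡ recurrence W
    ∑-weight-insMax = begin
        ∑ (allFin (suc n)) (λ x → weight p q S f g (insMax u x))
      ≡⟨ ∑-allFin-last n (λ x → weight p q S f g (insMax u x)) ⟩
        ∑ (allFin n) (λ x → weight p q S f g (insMax u (inject₁ x))) + weight p q S f g (insMax u (fromℕ n))
      ≡⟨ trans (ℤP.+-comm (∑ (allFin n) (λ x → weight p q S f g (insMax u (inject₁ x)))) (weight p q S f g (insMax u (fromℕ n))))
               (cong₂ _+_ weight-insMax-fix (∑-cong (allFin n) weight-insMax)) ⟩
        T * W S₀ f + ∑ (allFin n) (λ x → contribution x (X x))
      ≡⟨ cong (_+_ (T * W S₀ f)) (∑-affine (allFin n) L (W S₀ f) (W S₀ (f ∘ suc))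
           (λ x → (X x * Z x) * W (withFixed S₀ x) (f ∘ suc)) (λ x → X x * (Z x * E x)) (λ x → X x * (Z x * (1ℤ - E x)))) ⟩
        T * W S₀ f + L * - (∑ (allFin n) (λ x → (X x * Z x) * W (withFixed S₀ x) (f ∘ suc))
                            + ∑ (allFin n) (λ x → X x * (Z x * E x)) * W S₀ f
                            + ∑ (allFin n) (λ x → X x * (Z x * (1ℤ - E x))) * W S₀ (f ∘ suc))
      ≡⟨ cong₂ (λ a b → T * W S₀ f + L * - (∑ (allFin n) (λ x → (X x * Z x) * W (withFixed S₀ x) (f ∘ suc)) + a + b))
           (*-weight p q S₀ f g u _ (λ e → + e) ∑excAt)
           (*-weight p q S₀ (f ∘ suc) g u _ (λ e → + free p S₀ - + e) ∑¬excAt) ⟩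
        recurrence W
      ∎
      where open ≡-Reasoning

  ∑Perm-recurrence : (w : (Fin n → Bool) → (ℕ → ℤ) → Vec (Fin n) n → ℤ) →
    ∑Perm n (λ u → recurrence (λ S' f' → w S' f' u)) ≡ recurrence (λ S' f' → ∑Perm n (w S' f'))
  ∑Perm-recurrence w = begin
      ∑Perm n (λ u → T * w S₀ f u + L * - (a u + b u + c u))
    ≡⟨ ∑Perm-+ n _ _ ⟩
      ∑Perm n (λ u → T * w S₀ f u) + ∑Perm n (λ u → L * - (a u + b u + c u))
    ≡⟨ cong₂ _+_ (∑Perm-*ˡ n T (w S₀ f)) (trans (∑Perm-*ˡ n L _) (cong (L *_) (∑Perm-neg n _))) ⟩
      T * ∑Perm n (w S₀ f) + L * - ∑Perm n (λ u → a u + b u + c u)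
    ≡⟨ cong (λ z → T * ∑Perm n (w S₀ f) + L * - z) (trans (∑Perm-+ n _ c) (cong (_+ ∑Perm n c) (∑Perm-+ n a b))) ⟩
      T * ∑Perm n (w S₀ f) + L * - (∑Perm n a + ∑Perm n b + ∑Perm n c)
    ≡⟨ cong (λ z → T * ∑Perm n (w S₀ f) + L * - (z + ∑Perm n b + ∑Perm n c))
            (∑Perm-∑ n (allFin n) (λ x → X x * Z x) (λ x → w (withFixed S₀ x) (f ∘ suc))) ⟩
      recurrence (λ S' f' → ∑Perm n (w S' f'))
    ∎
    where
    open ≡-Reasoning
    a b c : Vec (Fin n) n → ℤ
    a u = ∑ (allFin n) (λ x → (X x * Z x) * w (withFixed S₀ x) (f ∘ suc) u)
    b = w S₀ (λ e → + e * f e)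
    c = w S₀ (λ e → (+ free p S₀ - + e) * f (suc e))

  Q-suc : Q (suc n) p q S f g ≡ recurrence (λ S' f' → Q n p q S' f' g)
  Q-suc = begin
      ∑Perm (suc n) (weight p q S f g)
    ≡⟨ ∑Perm-suc n (weight p q S f g) ⟩
      ∑Perm n (λ u → ∑ (allFin (suc n)) (λ x → weight p q S f g (insMax u x)))
    ≡⟨ ∑-cong (words n n) (λ u → 𝟙-*-cong (isPerm? u) (∑-weight-insMax u)) ⟩
      ∑Perm n (λ u → recurrence (λ S' f' → weight p q S' f' g u))
    ≡⟨ ∑Perm-recurrence (λ S' f' → weight p q S' f' g) ⟩
      recurrence (λ S' f' → Q n p q S' f' g)
    ∎
    where open ≡-Reasoning

free-last : ∀ {n} b (S : Fin (suc n) → Bool) →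
  + free b S ≡ + free b (S ∘ inject₁) + 𝟙 (n % 2 ℕP.≟ b) * 𝟙 (S (fromℕ n) BP.≟ false)
free-last {n} b S = begin
    + free b S
  ≡⟨ count-allFin-last n (λ i → (toℕ i % 2 ℕP.≟ b) ×-dec (S i BP.≟ false)) ⟩
    ∑ (allFin n) (λ i → 𝟙 ((toℕ (inject₁ i) % 2 ℕP.≟ b) ×-dec (S (inject₁ i) BP.≟ false)))
      + 𝟙 ((toℕ (fromℕ n) % 2 ℕP.≟ b) ×-dec (S (fromℕ n) BP.≟ false))
  ≡⟨ cong₂ _+_ (trans (∑-cong (allFin n) (λ i → 𝟙-⇔ (map₁ (trans (sym (inject₁-%2 i))))
                                                     (map₁ (trans (inject₁-%2 i))) _
                                                     ((toℕ i % 2 ℕP.≟ b) ×-dec (S (inject₁ i) BP.≟ false))))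
                      (sym (count≡∑𝟙 _ (allFin n))))
               (trans (𝟙-⇔ (map₁ (trans (sym (fromℕ-%2 n)))) (map₁ (trans (fromℕ-%2 n))) _
                           ((n % 2 ℕP.≟ b) ×-dec (S (fromℕ n) BP.≟ false)))
                      (𝟙-× (n % 2 ℕP.≟ b) (S (fromℕ n) BP.≟ false))) ⟩
    + free b (S ∘ inject₁) + 𝟙 (n % 2 ℕP.≟ b) * 𝟙 (S (fromℕ n) BP.≟ false)
  ∎
  where open ≡-Reasoning

free-withFixed : ∀ {n} b (S : Fin n → Bool) x → S x ≡ false →
  + free b (withFixed S x) + 𝟙 (toℕ x % 2 ℕP.≟ b) ≡ + free b S
free-withFixed {n} b S x Sx≡false = begin
    + free b (withFixed S x) + 𝟙 (toℕ x % 2 ℕP.≟ b)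
  ≡⟨ cong₂ _+_ (free≡∑ b (withFixed S x)) (sym (trans (cong (𝟙 (toℕ x % 2 ℕP.≟ b) *_) (𝟙-yes (S x BP.≟ false) Sx≡false))
                                                     (ℤP.*-identityʳ (𝟙 (toℕ x % 2 ℕP.≟ b))))) ⟩
    ∑ (allFin n) (λ j → P j * F (withFixed S x) j) + P x * F S x
  ≡⟨ ∑-allFin-swapAt (λ j → P j * F (withFixed S x) j) (λ j → P j * F S j) x
       (λ j j≢x → cong (λ z → P j * 𝟙 (z BP.≟ false)) (updateAt-minimal j x S j≢x)) ⟩
    ∑ (allFin n) (λ j → P j * F S j) + P x * F (withFixed S x) x
  ≡⟨ cong₂ _+_ (sym (free≡∑ b S)) (trans (cong (λ z → P x * 𝟙 (z BP.≟ false)) (updateAt-updates x S)) (ℤP.*-zeroʳ (P x))) ⟩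
    + free b S + 0ℤ
  ≡⟨ ℤP.+-identityʳ (+ free b S) ⟩
    + free b S
  ∎
  where
  open ≡-Reasoning
  P : Fin n → ℤ
  P j = 𝟙 (toℕ j % 2 ℕP.≟ b)
  F : (Fin n → Bool) → Fin n → ℤ
  F S' j = 𝟙 (S' j BP.≟ false)

𝟙-≟-true : ∀ {b} → b ≡ true → 𝟙 (b BP.≟ true) ≡ 1ℤ × 𝟙 (b BP.≟ false) ≡ 0ℤ
𝟙-≟-true refl = refl , refl

𝟙-≟-false : ∀ {b} → b ≡ false → 𝟙 (b BP.≟ true) ≡ 0ℤ × 𝟙 (b BP.≟ false) ≡ 1ℤ
𝟙-≟-false refl = refl , refl

Factorises : ℕ → ℕ → ℕ → Set
Factorises n p q = ∀ (S : Fin n → Bool) (f g : ℕ → ℤ) → Q n p q S f g ≡ D (free p S) f * D (free q S) g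

Factorises-swap : ∀ {n p q} → Factorises n p q → Factorises n q p
Factorises-swap {n} {p} {q} fact S f g = begin
    Q n q p S f g
  ≡⟨ ∑-cong (words n n) (λ v → cong (𝟙 (isPerm? v) *_) (lem (𝟙 (isPA? v)) (𝟙 (fixedSet? v S)) (f (exc q v)) (g (exc p v)) (sign v))) ⟩
    Q n p q S g f
  ≡⟨ fact S g f ⟩
    D (free p S) g * D (free q S) f
  ≡⟨ ℤP.*-comm (D (free p S) g) (D (free q S) f) ⟩
    D (free q S) f * D (free p S) g
  ∎
  where
  open ≡-Reasoning
  lem : ∀ a b x y s → a * (b * (x * (y * s))) ≡ a * (b * (y * (x * s)))
  lem = solve-∀

Factorises-zero : ∀ p q → Factorises 0 p q
Factorises-zero p q S f g = lem (f 0) (g 0)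
  where
  lem : ∀ a b → 1ℤ * (1ℤ * (1ℤ * (a * (b * 1ℤ)))) + 0ℤ ≡ a * b
  lem = solve-∀

module FactorisationStep {n : ℕ} (p q : ℕ) (p≡n : p ≡ n % 2) (q≢p : q ≢ p) (fact : Factorises n p q) (S : Fin (suc n) → Bool) (f g : ℕ → ℤ) where
  open Insertion p q p≡n q≢p S f g using (S₀; T; L; X; Z; recurrence; Q-suc)

  r : ℕ
  r = free p S₀
  Dq : ℤ
  Dq = D (free q S₀) g

  free-q-last : S (fromℕ n) ≡ false → free q S ≡ free q S₀
  free-q-last Sn≡false = ℤP.+-injective (trans (free-last q S) (trans
    (cong (λ z → + free q S₀ + z * 𝟙 (S (fromℕ n) BP.≟ false)) (𝟙-no (n % 2 ℕP.≟ q) (λ n≡q → q≢p (trans (sym n≡q) (sym p≡n)))))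
    (ℤP.+-identityʳ _)))

  Q-withFixed : ∀ x → (X x * Z x) * Q n p q (withFixed S₀ x) (f ∘ suc) g ≡ (X x * Z x) * (D (r ∸ 1) (f ∘ suc) * Dq)
  Q-withFixed x = trans (cong (_* Q n p q (withFixed S₀ x) (f ∘ suc) g) (sym (𝟙-× (toℕ x % 2 ℕP.≟ p) (S₀ x BP.≟ false))))
    (trans (𝟙-*-cong ((toℕ x % 2 ℕP.≟ p) ×-dec (S₀ x BP.≟ false)) (λ (x≡p , S₀x≡false) →
       trans (fact (withFixed S₀ x) (f ∘ suc) g) (cong₂ (λ a b → D a (f ∘ suc) * D b g) (free-p x≡p S₀x≡false) (free-q x≡p S₀x≡false))))
    (cong (_* (D (r ∸ 1) (f ∘ suc) * Dq)) (𝟙-× (toℕ x % 2 ℕP.≟ p) (S₀ x BP.≟ false))))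
    where
    free-p : toℕ x % 2 ≡ p → S₀ x ≡ false → free p (withFixed S₀ x) ≡ r ∸ 1
    free-p x≡p S₀x≡false = trans (sym (ℕP.m+n∸n≡m _ 1)) (cong (_∸ 1) (ℤP.+-injective
      (trans (cong (_+_ (+ free p (withFixed S₀ x))) (sym (𝟙-yes (toℕ x % 2 ℕP.≟ p) x≡p))) (free-withFixed p S₀ x S₀x≡false))))
    free-q : toℕ x % 2 ≡ p → S₀ x ≡ false → free q (withFixed S₀ x) ≡ free q S₀
    free-q x≡p S₀x≡false = ℤP.+-injective (trans (sym (ℤP.+-identityʳ _))
      (trans (cong (_+_ (+ free q (withFixed S₀ x))) (sym (𝟙-no (toℕ x % 2 ℕP.≟ q) (λ x≡q → q≢p (trans (sym x≡q) x≡p)))))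
             (free-withFixed q S₀ x S₀x≡false)))

  Q-fixed : S (fromℕ n) ≡ true → recurrence (λ S' f' → Q n p q S' f' g) ≡ D (free p S) f * D (free q S) g
  Q-fixed Sn≡true = begin
      T * Q n p q S₀ f g + L * - Σ
    ≡⟨ cong₂ (λ t l → t * Q n p q S₀ f g + l * - Σ) T≡1 L≡0 ⟩
      1ℤ * Q n p q S₀ f g + 0ℤ * - Σ
    ≡⟨ lem (Q n p q S₀ f g) (- Σ) ⟩
      Q n p q S₀ f g
    ≡⟨ fact S₀ f g ⟩
      D r f * Dq
    ≡⟨ cong₂ (λ a b → D a f * D b g) (sym (free-fixed p)) (sym (free-fixed q)) ⟩
      D (free p S) f * D (free q S) g
    ∎
    where
    open ≡-Reasoning
    T≡1 : T ≡ 1ℤ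
    T≡1 = proj₁ (𝟙-≟-true Sn≡true)
    L≡0 : L ≡ 0ℤ
    L≡0 = proj₂ (𝟙-≟-true Sn≡true)
    Σ : ℤ
    Σ = ∑ (allFin n) (λ x → (X x * Z x) * Q n p q (withFixed S₀ x) (f ∘ suc) g)
        + Q n p q S₀ (λ e → + e * f e) g + Q n p q S₀ (λ e → (+ r - + e) * f (suc e)) g
    lem : ∀ a b → 1ℤ * a + 0ℤ * b ≡ a
    lem = solve-∀
    free-fixed : ∀ b → free b S ≡ free b S₀
    free-fixed b = ℤP.+-injective (trans (free-last b S) (trans
      (cong (λ z → + free b S₀ + 𝟙 (n % 2 ℕP.≟ b) * z) L≡0)
      (trans (cong (_+_ (+ free b S₀)) (ℤP.*-zeroʳ (𝟙 (n % 2 ℕP.≟ b)))) (ℤP.+-identityʳ (+ free b S₀)))))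

  Q-free : S (fromℕ n) ≡ false → recurrence (λ S' f' → Q n p q S' f' g) ≡ D (free p S) f * D (free q S) g
  Q-free Sn≡false = begin
      T * Q₀ + L * - (Σx + Qₑ + Qₛ)
    ≡⟨ cong₂ (λ t l → t * Q₀ + l * - (Σx + Qₑ + Qₛ)) (proj₁ (𝟙-≟-false Sn≡false)) (proj₂ (𝟙-≟-false Sn≡false)) ⟩
      0ℤ * Q₀ + 1ℤ * - (Σx + Qₑ + Qₛ)
    ≡⟨ cong₂ (λ a b → 0ℤ * Q₀ + 1ℤ * - (a + b)) (cong₂ _+_ Σx≡ (fact S₀ (λ e → + e * f e) g))
                                                (fact S₀ (λ e → (+ r - + e) * f (suc e)) g) ⟩
      0ℤ * Q₀ + 1ℤ * - (+ r * (D₋ * Dq) + Dₑ * Dq + Dₛ * Dq)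
    ≡⟨ lem Q₀ (+ r) D₋ Dq Dₑ Dₛ ⟩
      - (Dₑ + Dₛ + + r * D₋) * Dq
    ≡⟨ cong (_* Dq) (sym (D-suc r f)) ⟩
      D (suc r) f * Dq
    ≡⟨ cong₂ (λ a b → D a f * D b g) (sym free-p) (sym (free-q-last Sn≡false)) ⟩
      D (free p S) f * D (free q S) g
    ∎
    where
    open ≡-Reasoning
    Q₀ Σx Qₑ Qₛ D₋ Dₑ Dₛ : ℤ
    Q₀ = Q n p q S₀ f g
    Σx = ∑ (allFin n) (λ x → (X x * Z x) * Q n p q (withFixed S₀ x) (f ∘ suc) g)
    Qₑ = Q n p q S₀ (λ e → + e * f e) g
    Qₛ = Q n p q S₀ (λ e → (+ r - + e) * f (suc e)) g
    D₋ = D (r ∸ 1) (f ∘ suc)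
    Dₑ = D r (λ e → + e * f e)
    Dₛ = D r (λ e → (+ r - + e) * f (suc e))
    Σx≡ : Σx ≡ + r * (D₋ * Dq)
    Σx≡ = trans (∑-cong (allFin n) Q-withFixed) (trans (∑-*ʳ (allFin n) _ (λ x → X x * Z x)) (cong (_* (D₋ * Dq)) (sym (free≡∑ p S₀))))
    lem : ∀ Q r d Dq a b → 0ℤ * Q + 1ℤ * - (r * (d * Dq) + a * Dq + b * Dq) ≡ - (a + b + r * d) * Dq
    lem = solve-∀
    free-p : free p S ≡ suc r
    free-p = trans (ℤP.+-injective (trans (free-last p S)
      (cong₂ (λ a b → + r + a * b) (𝟙-yes (n % 2 ℕP.≟ p) (sym p≡n)) (proj₂ (𝟙-≟-false Sn≡false))))) (ℕP.+-comm r 1)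

  Q-suc-factorises : Q (suc n) p q S f g ≡ D (free p S) f * D (free q S) g
  Q-suc-factorises with S (fromℕ n) in Sn
  ... | true = trans Q-suc (Q-fixed Sn)
  ... | false = trans Q-suc (Q-free Sn)

Factorises-suc : ∀ {n} p q → p ≡ n % 2 → q ≢ p → Factorises n p q → Factorises (suc n) p q
Factorises-suc p q p≡n q≢p fact S f g = FactorisationStep.Q-suc-factorises p q p≡n q≢p fact S f g

%2≡0⊎%2≡1 : ∀ n → n % 2 ≡ 0 ⊎ n % 2 ≡ 1
%2≡0⊎%2≡1 zero = inj₁ refl
%2≡0⊎%2≡1 (suc zero) = inj₂ refl
%2≡0⊎%2≡1 (suc (suc n)) = %2≡0⊎%2≡1 n

factorises : ∀ n → Factorises n 0 1
factorises zero = Factorises-zero 0 1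
factorises (suc n) with %2≡0⊎%2≡1 n
... | inj₁ n≡0 = Factorises-suc 0 1 (sym n≡0) (λ ()) (factorises n)
... | inj₂ n≡1 = Factorises-swap {suc n} {1} {0} (Factorises-suc 1 0 (sym n≡1) (λ ()) (Factorises-swap {n} {0} {1} (factorises n)))

∑₀ : ℕ → (ℕ → ℤ) → ℤ
∑₀ zero h = h 0
∑₀ (suc k) h = ∑₀ k h + h (suc k)

∑₀-cong : ∀ k {h h' : ℕ → ℤ} → (∀ j → j ≤ k → h j ≡ h' j) → ∑₀ k h ≡ ∑₀ k h'
∑₀-cong zero h≡h' = h≡h' 0 z≤n
∑₀-cong (suc k) h≡h' = cong₂ _+_ (∑₀-cong k (λ j j≤k → h≡h' j (ℕP.m≤n⇒m≤1+n j≤k))) (h≡h' (suc k) ℕP.≤-refl)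

∑₀-*ˡ : ∀ k c (h : ℕ → ℤ) → ∑₀ k (λ j → c * h j) ≡ c * ∑₀ k h
∑₀-*ˡ zero c h = refl
∑₀-*ˡ (suc k) c h = trans (cong (_+ c * h (suc k)) (∑₀-*ˡ k c h)) (sym (ℤP.*-distribˡ-+ c (∑₀ k h) (h (suc k))))

∑-∑₀ : ∀ {A : Set} (xs : List A) k (h : A → ℕ → ℤ) → ∑ xs (λ x → ∑₀ k (h x)) ≡ ∑₀ k (λ j → ∑ xs (λ x → h x j))
∑-∑₀ xs zero h = refl
∑-∑₀ xs (suc k) h = trans (∑-+ xs (λ x → ∑₀ k (h x)) (λ x → h x (suc k))) (cong (_+ ∑ xs (λ x → h x (suc k))) (∑-∑₀ xs k h))

∑₀-δ : ∀ k a (h : ℕ → ℤ) → ∑₀ k (λ j → 𝟙 (a ℕP.≟ j) * h j) ≡ 𝟙 (a ℕP.≤? k) * h a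
∑₀-δ zero zero h = refl
∑₀-δ zero (suc a) h = refl
∑₀-δ (suc k) a h with ℕP.<-cmp a (suc k)
... | tri< a<1+k a≢1+k _ = begin
      ∑₀ k (λ j → 𝟙 (a ℕP.≟ j) * h j) + 𝟙 (a ℕP.≟ suc k) * h (suc k)
    ≡⟨ cong₂ _+_ (∑₀-δ k a h) (cong (_* h (suc k)) (𝟙-no (a ℕP.≟ suc k) a≢1+k)) ⟩
      𝟙 (a ℕP.≤? k) * h a + 0ℤ * h (suc k)
    ≡⟨ cong (λ z → z * h a + 0ℤ) (trans (𝟙-yes (a ℕP.≤? k) (ℕP.≤-pred a<1+k)) (sym (𝟙-yes (a ℕP.≤? suc k) (ℕP.<⇒≤ a<1+k)))) ⟩
      𝟙 (a ℕP.≤? suc k) * h a + 0ℤ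
    ≡⟨ ℤP.+-identityʳ _ ⟩
      𝟙 (a ℕP.≤? suc k) * h a
    ∎
  where open ≡-Reasoning
... | tri≈ _ refl _ = begin
      ∑₀ k (λ j → 𝟙 (suc k ℕP.≟ j) * h j) + 𝟙 (suc k ℕP.≟ suc k) * h (suc k)
    ≡⟨ cong₂ _+_ (∑₀-δ k (suc k) h)
                 (cong (_* h (suc k)) (trans (𝟙-yes (suc k ℕP.≟ suc k) refl) (sym (𝟙-yes (suc k ℕP.≤? suc k) ℕP.≤-refl)))) ⟩
      𝟙 (suc k ℕP.≤? k) * h (suc k) + 𝟙 (suc k ℕP.≤? suc k) * h (suc k)
    ≡⟨ cong (λ z → z * h (suc k) + 𝟙 (suc k ℕP.≤? suc k) * h (suc k)) (𝟙-no (suc k ℕP.≤? k) (ℕP.<-irrefl refl)) ⟩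
      0ℤ + 𝟙 (suc k ℕP.≤? suc k) * h (suc k)
    ≡⟨ ℤP.+-identityˡ _ ⟩
      𝟙 (suc k ℕP.≤? suc k) * h (suc k)
    ∎
  where open ≡-Reasoning
... | tri> _ a≢1+k 1+k<a = begin
      ∑₀ k (λ j → 𝟙 (a ℕP.≟ j) * h j) + 𝟙 (a ℕP.≟ suc k) * h (suc k)
    ≡⟨ cong₂ _+_ (∑₀-δ k a h) (cong (_* h (suc k)) (𝟙-no (a ℕP.≟ suc k) a≢1+k)) ⟩
      𝟙 (a ℕP.≤? k) * h a + 0ℤ * h (suc k)
    ≡⟨ cong (λ z → z * h a + 0ℤ) (trans (𝟙-no (a ℕP.≤? k) (ℕP.<⇒≱ (ℕP.<-trans (ℕP.n<1+n k) 1+k<a)))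
                                        (sym (𝟙-no (a ℕP.≤? suc k) (ℕP.<⇒≱ 1+k<a)))) ⟩
      𝟙 (a ℕP.≤? suc k) * h a + 0ℤ
    ≡⟨ ℤP.+-identityʳ _ ⟩
      𝟙 (a ℕP.≤? suc k) * h a
    ∎
  where open ≡-Reasoning

δ : ℕ → ℕ → ℤ
δ j e = 𝟙 (e ℕP.≟ j)

𝟙-+ : ∀ a b k → 𝟙 (a ℕ.+ b ℕP.≟ k) ≡ ∑₀ k (λ j → δ j a * δ (k ∸ j) b)
𝟙-+ a b k = sym (trans (∑₀-δ k a (λ j → 𝟙 (b ℕP.≟ k ∸ j))) (trans (sym (𝟙-× (a ℕP.≤? k) (b ℕP.≟ k ∸ a)))
  (𝟙-⇔ (λ (a≤k , b≡k-a) → trans (cong (a ℕ.+_) b≡k-a) (ℕP.m+[n∸m]≡n a≤k))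
        (λ { refl → ℕP.m≤m+n a b , sym (ℕP.m+n∸m≡n a b) }) _ _)))

negOnePow≡𝟙-𝟙 : ∀ m → 𝟙 (m % 2 ℕP.≟ 0) - 𝟙 (m % 2 ℕP.≟ 1) ≡ negOnePow m
negOnePow≡𝟙-𝟙 zero = refl
negOnePow≡𝟙-𝟙 (suc zero) = refl
negOnePow≡𝟙-𝟙 (suc (suc m)) = trans (negOnePow≡𝟙-𝟙 m) (sym (ℤP.neg-involutive (negOnePow m)))

excedances≡exc+exc : ∀ {n} (σ : Vec (Fin n) n) → excedances σ ≡ exc 0 σ ℕ.+ exc 1 σ
excedances≡exc+exc {n} σ = ℤP.+-injective (begin
    + excedances σ
  ≡⟨ count≡∑𝟙 _ (allFin n) ⟩
    ∑ (allFin n) (λ i → 𝟙 (toℕ i <? toℕ (lookup σ i)))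
  ≡⟨ ∑-cong (allFin n) (λ i → by-parity i (%2≡0⊎%2≡1 (toℕ i))) ⟩
    ∑ (allFin n) (λ i → 𝟙 (excAt? 0 σ i) + 𝟙 (excAt? 1 σ i))
  ≡⟨ ∑-+ (allFin n) _ _ ⟩
    ∑ (allFin n) (λ i → 𝟙 (excAt? 0 σ i)) + ∑ (allFin n) (λ i → 𝟙 (excAt? 1 σ i))
  ≡⟨ cong₂ _+_ (sym (count≡∑𝟙 (excAt? 0 σ) (allFin n))) (sym (count≡∑𝟙 (excAt? 1 σ) (allFin n))) ⟩
    + exc 0 σ + + exc 1 σ
  ∎)
  where
  open ≡-Reasoning
  by-parity : ∀ i → toℕ i % 2 ≡ 0 ⊎ toℕ i % 2 ≡ 1 → 𝟙 (toℕ i <? toℕ (lookup σ i)) ≡ 𝟙 (excAt? 0 σ i) + 𝟙 (excAt? 1 σ i)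
  by-parity i (inj₁ i≡0) = trans (sym (ℤP.+-identityʳ (𝟙 (toℕ i <? toℕ (lookup σ i)))))
    (cong₂ _+_ (𝟙-⇔ (i≡0 ,_) proj₂ (toℕ i <? toℕ (lookup σ i)) (excAt? 0 σ i))
               (sym (𝟙-no (excAt? 1 σ i) (λ (i≡1 , _) → ℕP.0≢1+n (trans (sym i≡0) i≡1)))))
  by-parity i (inj₂ i≡1) = trans (sym (ℤP.+-identityˡ (𝟙 (toℕ i <? toℕ (lookup σ i)))))
    (cong₂ _+_ (sym (𝟙-no (excAt? 0 σ i) (λ (i≡0 , _) → ℕP.0≢1+n (trans (sym i≡0) i≡1))))
               (𝟙-⇔ (i≡1 ,_) proj₂ (toℕ i <? toℕ (lookup σ i)) (excAt? 1 σ i)))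

𝟙-isDerangement : ∀ {n} (σ : Vec (Fin n) n) → 𝟙 (isDerangement? σ) ≡ 𝟙 (fixedSet? σ (const false))
𝟙-isDerangement σ = 𝟙-⇔ (λ der i → dec-false (lookup σ i FP.≟ i) (der i))
                        (λ fix i σi≡i → true≢false (trans (sym (dec-true (lookup σ i FP.≟ i) σi≡i)) (fix i))) _ _
  where
  true≢false : true ≢ false
  true≢false ()

∅ : ∀ {n} → Fin n → Bool
∅ = const false

𝟙-isPADk : ∀ {n} k (σ : Vec (Fin n) n) → 𝟙 (isPADk? k σ) ≡
  𝟙 (isPerm? σ) * (𝟙 (isPA? σ) * (𝟙 (fixedSet? σ ∅) * ∑₀ k (λ j → δ j (exc 0 σ) * δ (k ∸ j) (exc 1 σ))))
𝟙-isPADk k σ = trans (𝟙-× (isPerm? σ) _) (cong (𝟙 (isPerm? σ) *_) (trans (𝟙-× (isPA? σ) _) (cong (𝟙 (isPA? σ) *_)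
  (trans (𝟙-× (isDerangement? σ) _) (cong₂ _*_ (𝟙-isDerangement σ)
    (trans (cong (λ e → 𝟙 (e ℕP.≟ k)) (excedances≡exc+exc σ)) (𝟙-+ (exc 0 σ) (exc 1 σ) k)))))))

signed-𝟙-isPADk : ∀ {n} k (σ : Vec (Fin n) n) →
  𝟙 (isPADk? k σ ×-dec isEven? σ) - 𝟙 (isPADk? k σ ×-dec isOdd? σ) ≡ ∑₀ k (λ j → 𝟙 (isPerm? σ) * weight 0 1 ∅ (δ j) (δ (k ∸ j)) σ)
signed-𝟙-isPADk {n} k σ = begin
    𝟙 (isPADk? k σ ×-dec isEven? σ) - 𝟙 (isPADk? k σ ×-dec isOdd? σ)
  ≡⟨ trans (cong₂ _-_ (𝟙-× (isPADk? k σ) (isEven? σ)) (𝟙-× (isPADk? k σ) (isOdd? σ))) (l₁ (𝟙 (isPADk? k σ)) _ _) ⟩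
    𝟙 (isPADk? k σ) * (𝟙 (isEven? σ) - 𝟙 (isOdd? σ))
  ≡⟨ cong₂ _*_ (𝟙-isPADk k σ) (negOnePow≡𝟙-𝟙 (n ∸ cycles σ)) ⟩
    (P * (A * (F * ∑₀ k h))) * sign σ
  ≡⟨ trans (l₂ P A F (∑₀ k h) (sign σ)) (sym (∑₀-*ˡ k (P * (A * (F * sign σ))) h)) ⟩
    ∑₀ k (λ j → (P * (A * (F * sign σ))) * h j)
  ≡⟨ ∑₀-cong k (λ j _ → l₃ P A F (sign σ) (δ j (exc 0 σ)) (δ (k ∸ j) (exc 1 σ))) ⟩
    ∑₀ k (λ j → 𝟙 (isPerm? σ) * weight 0 1 ∅ (δ j) (δ (k ∸ j)) σ)
  ∎
  where
  open ≡-Reasoning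
  P A F : ℤ
  P = 𝟙 (isPerm? σ)
  A = 𝟙 (isPA? σ)
  F = 𝟙 (fixedSet? σ ∅)
  h : ℕ → ℤ
  h j = δ j (exc 0 σ) * δ (k ∸ j) (exc 1 σ)
  l₁ : ∀ d e o → d * e - d * o ≡ d * (e - o)
  l₁ = solve-∀
  l₂ : ∀ p a f t s → (p * (a * (f * t))) * s ≡ (p * (a * (f * s))) * t
  l₂ = solve-∀
  l₃ : ∀ p a f s x y → (p * (a * (f * s))) * (x * y) ≡ p * (a * (f * (x * (y * s))))
  l₃ = solve-∀

dEven-dOdd≡∑Q : ∀ n k → + dEven n k - + dOdd n k ≡ ∑₀ k (λ j → Q n 0 1 ∅ (δ j) (δ (k ∸ j)))
dEven-dOdd≡∑Q n k = begin
    + dEven n k - + dOdd n k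
  ≡⟨ cong₂ _-_ (count≡∑𝟙 _ (words n n)) (count≡∑𝟙 _ (words n n)) ⟩
    ∑ (words n n) (λ σ → 𝟙 (isPADk? k σ ×-dec isEven? σ)) - ∑ (words n n) (λ σ → 𝟙 (isPADk? k σ ×-dec isOdd? σ))
  ≡⟨ sym (∑-sub (words n n) _ _) ⟩
    ∑ (words n n) (λ σ → 𝟙 (isPADk? k σ ×-dec isEven? σ) - 𝟙 (isPADk? k σ ×-dec isOdd? σ))
  ≡⟨ ∑-cong (words n n) (signed-𝟙-isPADk k) ⟩
    ∑ (words n n) (λ σ → ∑₀ k (λ j → 𝟙 (isPerm? σ) * weight 0 1 ∅ (δ j) (δ (k ∸ j)) σ))
  ≡⟨ ∑-∑₀ (words n n) k _ ⟩
    ∑₀ k (λ j → Q n 0 1 ∅ (δ j) (δ (k ∸ j)))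
  ∎
  where open ≡-Reasoning

∑₀-interval : ∀ k lo hi → hi ≤ k → ∑₀ k (λ j → 𝟙 (lo ℕP.≤? j) * 𝟙 (j ℕP.≤? hi)) ≡ + (suc hi ∸ lo)
∑₀-interval zero zero zero z≤n = refl
∑₀-interval zero (suc lo) zero z≤n = cong +_ (sym (ℕP.0∸n≡0 lo))
∑₀-interval (suc k) lo hi hi≤sk with hi ℕP.≤? k
... | yes hk = begin
      ∑₀ k (λ j → 𝟙 (lo ℕP.≤? j) * 𝟙 (j ℕP.≤? hi)) + 𝟙 (lo ℕP.≤? suc k) * 𝟙 (suc k ℕP.≤? hi)
    ≡⟨ cong₂ _+_ (∑₀-interval k lo hi hk)
                 (cong (𝟙 (lo ℕP.≤? suc k) *_) (𝟙-no (suc k ℕP.≤? hi) (λ le → ℕP.<-irrefl refl (ℕP.≤-trans le hk)))) ⟩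
      + (suc hi ∸ lo) + 𝟙 (lo ℕP.≤? suc k) * 0ℤ
    ≡⟨ trans (cong (_+_ (+ (suc hi ∸ lo))) (ℤP.*-zeroʳ (𝟙 (lo ℕP.≤? suc k)))) (ℤP.+-identityʳ (+ (suc hi ∸ lo))) ⟩
      + (suc hi ∸ lo)
    ∎
  where open ≡-Reasoning
... | no nhk with ℕP.≤-antisym hi≤sk (ℕP.≰⇒> nhk)
...   | refl = begin
      ∑₀ k (λ j → 𝟙 (lo ℕP.≤? j) * 𝟙 (j ℕP.≤? suc k)) + 𝟙 (lo ℕP.≤? suc k) * 𝟙 (suc k ℕP.≤? suc k)
    ≡⟨ cong₂ _+_ (∑₀-cong k (λ j le → cong (𝟙 (lo ℕP.≤? j) *_)
                   (trans (𝟙-yes (j ℕP.≤? suc k) (ℕP.m≤n⇒m≤1+n le)) (sym (𝟙-yes (j ℕP.≤? k) le)))))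
                 (cong (𝟙 (lo ℕP.≤? suc k) *_) (𝟙-yes (suc k ℕP.≤? suc k) ℕP.≤-refl)) ⟩
      ∑₀ k (λ j → 𝟙 (lo ℕP.≤? j) * 𝟙 (j ℕP.≤? k)) + 𝟙 (lo ℕP.≤? suc k) * 1ℤ
    ≡⟨ cong₂ _+_ (∑₀-interval k lo k ℕP.≤-refl) (ℤP.*-identityʳ (𝟙 (lo ℕP.≤? suc k))) ⟩
      + (suc k ∸ lo) + 𝟙 (lo ℕP.≤? suc k)
    ≡⟨ fin (lo ℕP.≤? suc k) ⟩
      + (suc (suc k) ∸ lo)
    ∎
  where
  open ≡-Reasoning
  fin : (d : Dec (lo ≤ suc k)) → + (suc k ∸ lo) + 𝟙 d ≡ + (suc (suc k) ∸ lo)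
  fin (yes le) = cong +_ (trans (ℕP.+-comm (suc k ∸ lo) 1) (sym (ℕP.+-∸-assoc 1 le)))
  fin (no nle) = cong +_ (trans (ℕP.+-identityʳ (suc k ∸ lo))
                          (trans (ℕP.m≤n⇒m∸n≡0 (ℕP.<⇒≤ (ℕP.≰⇒> nle))) (sym (ℕP.m≤n⇒m∸n≡0 (ℕP.≰⇒> nle)))))

inRange : ℕ → ℕ → ℤ
inRange A j = 𝟙 ((1 ℕP.≤? j) ×-dec (j ℕP.≤? A))

-- For k ≤ B + 1 only the constraints 1 ≤ j and 1 ≤ k ∸ j are active.
∑₀-inRange-inRange-short : ∀ A B k₁ → B ≤ A → k₁ ≤ B →
  ∑₀ (suc k₁) (λ j → inRange A j * inRange B (suc k₁ ∸ j)) ≡ + k₁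
∑₀-inRange-inRange-short A B k₁ B≤A k₁≤B = begin
    ∑₀ k (λ j → inRange A j * inRange B (k ∸ j))
  ≡⟨ ∑₀-cong k (λ j _ → trans (sym (𝟙-× ((1 ℕP.≤? j) ×-dec (j ℕP.≤? A)) ((1 ℕP.≤? k ∸ j) ×-dec (k ∸ j ℕP.≤? B))))
       (trans (𝟙-⇔ (λ ((1≤j , _) , (1≤k∸j , _)) → 1≤j , 1≤k∸j⇒j≤k₁ j 1≤k∸j)
                   (λ (1≤j , j≤k₁) → (1≤j , ℕP.≤-trans j≤k₁ (ℕP.≤-trans k₁≤B B≤A))
                                     , (j≤k₁⇒1≤k∸j j j≤k₁ , ℕP.≤-trans (ℕP.∸-monoʳ-≤ k 1≤j) k₁≤B)) _ _)
              (𝟙-× (1 ℕP.≤? j) (j ℕP.≤? k₁)))) ⟩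
    ∑₀ k (λ j → 𝟙 (1 ℕP.≤? j) * 𝟙 (j ℕP.≤? k₁))
  ≡⟨ ∑₀-interval k 1 k₁ (ℕP.n≤1+n k₁) ⟩
    + k₁
  ∎
  where
  open ≡-Reasoning
  k : ℕ
  k = suc k₁
  1≤k∸j⇒j≤k₁ : ∀ j → 1 ≤ k ∸ j → j ≤ k₁
  1≤k∸j⇒j≤k₁ j 1≤k∸j = ℕP.≤-pred (ℕP.m∸n≢0⇒n<m (λ k∸j≡0 → ℕP.<-irrefl refl (subst (1 ≤_) k∸j≡0 1≤k∸j)))
  j≤k₁⇒1≤k∸j : ∀ j → j ≤ k₁ → 1 ≤ k ∸ j
  j≤k₁⇒1≤k∸j j j≤k₁ = ℕP.m<n⇒0<n∸m (s≤s j≤k₁)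

-- For k > B + 1 only the constraints j ≤ A and k ∸ j ≤ B are active.
∑₀-inRange-inRange-long : ∀ A B t → A ≤ suc B → let k₁ = suc B ℕ.+ t in
  ∑₀ (suc k₁) (λ j → inRange A j * inRange B (suc k₁ ∸ j)) ≡ + (k₁ ⊓ ((suc A ℕ.+ suc B) ∸ (suc k₁ ℕ.+ 1)))
∑₀-inRange-inRange-long A B t A≤1+B = begin
    ∑₀ k (λ j → inRange A j * inRange B (k ∸ j))
  ≡⟨ ∑₀-cong k (λ j _ → trans (sym (𝟙-× ((1 ℕP.≤? j) ×-dec (j ℕP.≤? A)) ((1 ℕP.≤? k ∸ j) ×-dec (k ∸ j ℕP.≤? B))))
       (trans (𝟙-⇔ (λ ((_ , j≤A) , (_ , k∸j≤B)) → k∸j≤B⇒lo≤j j k∸j≤B , j≤A)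
                   (λ (lo≤j , j≤A) → (ℕP.≤-trans (s≤s z≤n) lo≤j , j≤A)
                                     , (ℕP.m<n⇒0<n∸m (ℕP.≤-<-trans j≤A A<k) , lo≤j⇒k∸j≤B j lo≤j)) _ _)
              (𝟙-× (suc (suc t) ℕP.≤? j) (j ℕP.≤? A)))) ⟩
    ∑₀ k (λ j → 𝟙 (suc (suc t) ℕP.≤? j) * 𝟙 (j ℕP.≤? A))
  ≡⟨ ∑₀-interval k (suc (suc t)) A (ℕP.<⇒≤ A<k) ⟩
    + (A ∸ suc t)
  ≡⟨ cong +_ (sym (trans (ℕP.m≥n⇒m⊓n≡n rest≤k₁) rest≡)) ⟩
    + ((suc B ℕ.+ t) ⊓ ((suc A ℕ.+ suc B) ∸ (k ℕ.+ 1)))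
  ∎
  where
  open ≡-Reasoning
  k : ℕ
  k = suc (suc B ℕ.+ t)
  k≡B+lo : k ≡ B ℕ.+ suc (suc t)
  k≡B+lo = lem B t
    where
    lem : ∀ b t → suc (suc b ℕ.+ t) ≡ b ℕ.+ suc (suc t)
    lem = ℕS.solve-∀
  A<k : A < k
  A<k = s≤s (ℕP.≤-trans A≤1+B (ℕP.m≤m+n (suc B) t))
  k∸j≤B⇒lo≤j : ∀ j → k ∸ j ≤ B → suc (suc t) ≤ j
  k∸j≤B⇒lo≤j j k∸j≤B = ℕP.+-cancelˡ-≤ B _ _ (subst (_≤ B ℕ.+ j) k≡B+lo
    (ℕP.≤-trans (ℕP.m≤n+m∸n k j) (ℕP.≤-trans (ℕP.+-monoʳ-≤ j k∸j≤B) (ℕP.≤-reflexive (ℕP.+-comm j B)))))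
  lo≤j⇒k∸j≤B : ∀ j → suc (suc t) ≤ j → k ∸ j ≤ B
  lo≤j⇒k∸j≤B j lo≤j = ℕP.m≤n+o⇒m∸n≤o k j (subst (_≤ j ℕ.+ B) (sym k≡B+lo)
    (ℕP.≤-trans (ℕP.+-monoʳ-≤ B lo≤j) (ℕP.≤-reflexive (ℕP.+-comm B j))))
  rest≡ : (suc A ℕ.+ suc B) ∸ (k ℕ.+ 1) ≡ A ∸ suc t
  rest≡ = trans (cong₂ _∸_ (lem₁ A B) (lem₂ B t)) (ℕP.[m+n]∸[m+o]≡n∸o (suc (suc B)) A (suc t))
    where
    lem₁ : ∀ a b → suc a ℕ.+ suc b ≡ suc (suc b) ℕ.+ a
    lem₁ = ℕS.solve-∀
    lem₂ : ∀ b t → suc (suc b ℕ.+ t) ℕ.+ 1 ≡ suc (suc b) ℕ.+ suc t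
    lem₂ = ℕS.solve-∀
  rest≤k₁ : (suc A ℕ.+ suc B) ∸ (k ℕ.+ 1) ≤ suc B ℕ.+ t
  rest≤k₁ = subst (_≤ suc B ℕ.+ t) (sym rest≡) (ℕP.≤-trans (ℕP.m∸n≤m A (suc t)) (ℕP.≤-trans A≤1+B (ℕP.m≤m+n (suc B) t)))

∑₀-inRange-inRange : ∀ A B k → B ≤ A → A ≤ suc B →
  ∑₀ k (λ j → inRange A j * inRange B (k ∸ j)) ≡ + ((k ∸ 1) ⊓ ((suc A ℕ.+ suc B) ∸ (k ℕ.+ 1)))
∑₀-inRange-inRange A B zero B≤A A≤1+B = refl
∑₀-inRange-inRange A B (suc k₁) B≤A A≤1+B with k₁ ℕP.≤? B
... | yes k₁≤B = trans (∑₀-inRange-inRange-short A B k₁ B≤A k₁≤B) (cong +_ (sym (ℕP.m≤n⇒m⊓n≡m k₁≤rest)))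
  where
  k₁≤rest : k₁ ≤ (suc A ℕ.+ suc B) ∸ (suc k₁ ℕ.+ 1)
  k₁≤rest = ℕP.m+n≤o⇒m≤o∸n k₁ (subst₂ _≤_ (lem₁ k₁) (lem₂ A B) (s≤s (s≤s (ℕP.+-mono-≤ (ℕP.≤-trans k₁≤B B≤A) k₁≤B))))
    where
    lem₁ : ∀ a → suc (suc (a ℕ.+ a)) ≡ a ℕ.+ (suc a ℕ.+ 1)
    lem₁ = ℕS.solve-∀
    lem₂ : ∀ a b → suc (suc (a ℕ.+ b)) ≡ suc a ℕ.+ suc b
    lem₂ = ℕS.solve-∀
... | no k₁≰B = subst (λ k₁ → ∑₀ (suc k₁) (λ j → inRange A j * inRange B (suc k₁ ∸ j))
                             ≡ + (k₁ ⊓ ((suc A ℕ.+ suc B) ∸ (suc k₁ ℕ.+ 1))))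
                      (ℕP.m+[n∸m]≡n (ℕP.≰⇒> k₁≰B)) (∑₀-inRange-inRange-long A B (k₁ ∸ suc B) A≤1+B)

∑₁-δ : ∀ A j → ∑₁ A (δ j) ≡ inRange A j
∑₁-δ zero j = sym (𝟙-no ((1 ℕP.≤? j) ×-dec (j ℕP.≤? 0)) (λ (1≤j , j≤0) → ℕP.<-irrefl refl (ℕP.≤-trans 1≤j j≤0)))
∑₁-δ (suc A) j = trans (cong (_+ 𝟙 (suc A ℕP.≟ j)) (∑₁-δ A j))
  (sym (𝟙-⊎ to from disjoint ((1 ℕP.≤? j) ×-dec (j ℕP.≤? suc A)) ((1 ℕP.≤? j) ×-dec (j ℕP.≤? A)) (suc A ℕP.≟ j)))
  where
  to : 1 ≤ j × j ≤ suc A → (1 ≤ j × j ≤ A) ⊎ suc A ≡ j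
  to (1≤j , j≤1+A) with j ℕP.≤? A
  ... | yes j≤A = inj₁ (1≤j , j≤A)
  ... | no j≰A = inj₂ (ℕP.≤-antisym (ℕP.≰⇒> j≰A) j≤1+A)
  from : (1 ≤ j × j ≤ A) ⊎ suc A ≡ j → 1 ≤ j × j ≤ suc A
  from (inj₁ (1≤j , j≤A)) = 1≤j , ℕP.m≤n⇒m≤1+n j≤A
  from (inj₂ refl) = s≤s z≤n , ℕP.≤-refl
  disjoint : 1 ≤ j × j ≤ A → suc A ≡ j → ⊥
  disjoint (_ , j≤A) refl = ℕP.<-irrefl refl j≤A

negOnePow-+ : ∀ a b → negOnePow (a ℕ.+ b) ≡ negOnePow a * negOnePow b
negOnePow-+ zero b = sym (ℤP.*-identityˡ (negOnePow b))
negOnePow-+ (suc a) b = trans (cong -_ (negOnePow-+ a b)) (ℤP.neg-distribˡ-* (negOnePow a) (negOnePow b))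

∑₀-D-D : ∀ A B k → B ≤ A → A ≤ suc B →
  ∑₀ k (λ j → D (suc A) (δ j) * D (suc B) (δ (k ∸ j))) ≡ negOnePow (suc A ℕ.+ suc B) * + ((k ∸ 1) ⊓ ((suc A ℕ.+ suc B) ∸ (k ℕ.+ 1)))
∑₀-D-D A B k B≤A A≤1+B = begin
    ∑₀ k (λ j → (negOnePow A * ∑₁ A (δ j)) * (negOnePow B * ∑₁ B (δ (k ∸ j))))
  ≡⟨ ∑₀-cong k (λ j _ → trans (cong₂ (λ x y → (negOnePow A * x) * (negOnePow B * y)) (∑₁-δ A j) (∑₁-δ B (k ∸ j)))
                               (lem (negOnePow A) (negOnePow B) (inRange A j) (inRange B (k ∸ j)))) ⟩
    ∑₀ k (λ j → (negOnePow A * negOnePow B) * (inRange A j * inRange B (k ∸ j)))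
  ≡⟨ ∑₀-*ˡ k (negOnePow A * negOnePow B) (λ j → inRange A j * inRange B (k ∸ j)) ⟩
    (negOnePow A * negOnePow B) * ∑₀ k (λ j → inRange A j * inRange B (k ∸ j))
  ≡⟨ cong₂ _*_ (sym sign≡) (∑₀-inRange-inRange A B k B≤A A≤1+B) ⟩
    negOnePow (suc A ℕ.+ suc B) * + ((k ∸ 1) ⊓ ((suc A ℕ.+ suc B) ∸ (k ℕ.+ 1)))
  ∎
  where
  open ≡-Reasoning
  lem : ∀ a b x y → (a * x) * (b * y) ≡ (a * b) * (x * y)
  lem = solve-∀
  sign≡ : negOnePow (suc A ℕ.+ suc B) ≡ negOnePow A * negOnePow B
  sign≡ = trans (cong negOnePow (ℕP.+-suc (suc A) B)) (trans (ℤP.neg-involutive (negOnePow (A ℕ.+ B))) (negOnePow-+ A B))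

𝟙-%2+𝟙-%2 : ∀ n b → b ≤ 1 → 𝟙 (n % 2 ℕP.≟ b) + 𝟙 (suc n % 2 ℕP.≟ b) ≡ 1ℤ
𝟙-%2+𝟙-%2 zero zero _ = refl
𝟙-%2+𝟙-%2 zero (suc zero) _ = refl
𝟙-%2+𝟙-%2 (suc zero) zero _ = refl
𝟙-%2+𝟙-%2 (suc zero) (suc zero) _ = refl
𝟙-%2+𝟙-%2 (suc (suc n)) b b≤1 = 𝟙-%2+𝟙-%2 n b b≤1
𝟙-%2+𝟙-%2 _ (suc (suc _)) (s≤s ())

free-∅-+2 : ∀ n b → b ≤ 1 → free {suc (suc n)} b ∅ ≡ suc (free {n} b ∅)
free-∅-+2 n b b≤1 = ℤP.+-injective (begin
    + free {suc (suc n)} b ∅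
  ≡⟨ free-last {suc n} b ∅ ⟩
    + free {suc n} b ∅ + 𝟙 (suc n % 2 ℕP.≟ b) * 1ℤ
  ≡⟨ cong₂ _+_ (free-last {n} b ∅) (ℤP.*-identityʳ (𝟙 (suc n % 2 ℕP.≟ b))) ⟩
    (+ free {n} b ∅ + 𝟙 (n % 2 ℕP.≟ b) * 1ℤ) + 𝟙 (suc n % 2 ℕP.≟ b)
  ≡⟨ trans (cong (λ z → (+ free {n} b ∅ + z) + 𝟙 (suc n % 2 ℕP.≟ b)) (ℤP.*-identityʳ (𝟙 (n % 2 ℕP.≟ b))))
           (ℤP.+-assoc (+ free {n} b ∅) (𝟙 (n % 2 ℕP.≟ b)) (𝟙 (suc n % 2 ℕP.≟ b))) ⟩
    + free {n} b ∅ + (𝟙 (n % 2 ℕP.≟ b) + 𝟙 (suc n % 2 ℕP.≟ b))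
  ≡⟨ cong (_+_ (+ free {n} b ∅)) (𝟙-%2+𝟙-%2 n b b≤1) ⟩
    + free {n} b ∅ + 1ℤ
  ≡⟨ ℤP.+-comm (+ free {n} b ∅) 1ℤ ⟩
    + suc (free {n} b ∅)
  ∎)
  where open ≡-Reasoning

record ParitySplit (n : ℕ) : Set where
  field
    a b : ℕ
    free-even : free {n} 0 ∅ ≡ suc a
    free-odd : free {n} 1 ∅ ≡ suc b
    b≤a : b ≤ a
    a≤1+b : a ≤ suc b
    n≡ : n ≡ suc a ℕ.+ suc b

paritySplit : ∀ n → 2 ≤ n → ParitySplit n
paritySplit (suc zero) (s≤s ())
paritySplit (suc (suc zero)) _ = record { a = 0 ; b = 0 ; free-even = refl ; free-odd = refl ; b≤a = z≤n ; a≤1+b = z≤n ; n≡ = refl }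
paritySplit (suc (suc (suc zero))) _ = record { a = 1 ; b = 0 ; free-even = refl ; free-odd = refl ; b≤a = z≤n ; a≤1+b = s≤s z≤n ; n≡ = refl }
paritySplit (suc (suc n@(suc (suc _)))) _ = record
  { a = suc a
  ; b = suc b
  ; free-even = trans (free-∅-+2 n 0 z≤n) (cong suc free-even)
  ; free-odd = trans (free-∅-+2 n 1 ℕP.≤-refl) (cong suc free-odd)
  ; b≤a = s≤s b≤a
  ; a≤1+b = s≤s a≤1+b
  ; n≡ = trans (cong (suc ∘ suc) n≡) (cong (suc ∘ suc) (sym (ℕP.+-suc a (suc b))))
  }
  where open ParitySplit (paritySplit n (s≤s (s≤s z≤n)))

∑₀-D-D-∅ : ∀ n k → 2 ≤ n →
  ∑₀ k (λ j → D (free {n} 0 ∅) (δ j) * D (free {n} 1 ∅) (δ (k ∸ j))) ≡ negOnePow n * + ((k ∸ 1) ⊓ (n ∸ (k ℕ.+ 1)))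
∑₀-D-D-∅ n k 2≤n = begin
    ∑₀ k (λ j → D (free {n} 0 ∅) (δ j) * D (free {n} 1 ∅) (δ (k ∸ j)))
  ≡⟨ cong₂ (λ A B → ∑₀ k (λ j → D A (δ j) * D B (δ (k ∸ j)))) free-even free-odd ⟩
    ∑₀ k (λ j → D (suc a) (δ j) * D (suc b) (δ (k ∸ j)))
  ≡⟨ ∑₀-D-D a b k b≤a a≤1+b ⟩
    negOnePow (suc a ℕ.+ suc b) * + ((k ∸ 1) ⊓ ((suc a ℕ.+ suc b) ∸ (k ℕ.+ 1)))
  ≡⟨ cong (λ m → negOnePow m * + ((k ∸ 1) ⊓ (m ∸ (k ℕ.+ 1)))) (sym n≡) ⟩
    negOnePow n * + ((k ∸ 1) ⊓ (n ∸ (k ℕ.+ 1)))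
  ∎
  where
  open ≡-Reasoning
  open ParitySplit (paritySplit n 2≤n)

-- The identity holds for every k once n ≥ 2.
proposition7 : (n k : ℕ) → 4 ≤ n → 2 ≤ k → k ≤ n ∸ 2 →
    (+ dEven n k) - (+ dOdd n k) ≡ negOnePow n * (+ ((k ∸ 1) ⊓ (n ∸ (k +ℕ 1))))
proposition7 n k 4≤n _ _ = begin
    + dEven n k - + dOdd n k
  ≡⟨ dEven-dOdd≡∑Q n k ⟩
    ∑₀ k (λ j → Q n 0 1 ∅ (δ j) (δ (k ∸ j)))
  ≡⟨ ∑₀-cong k (λ j _ → factorises n ∅ (δ j) (δ (k ∸ j))) ⟩
    ∑₀ k (λ j → D (free {n} 0 ∅) (δ j) * D (free {n} 1 ∅) (δ (k ∸ j)))
  ≡⟨ ∑₀-D-D-∅ n k (ℕP.≤-trans (s≤s (s≤s z≤n)) 4≤n) ⟩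
    negOnePow n * + ((k ∸ 1) ⊓ (n ∸ (k +ℕ 1)))
  ∎
  where open ≡-Reasoning
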